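{- Let $p$ be a prime, $q$ a power of $p$, and $k\ge 0$ an integer. The map $\bar{\mathcal{B}}_k:\mathbf{F}_q^2\to\mathbf{F}_q^2$ obtained by reducing the integer coefficients of $\mathcal{B}_k$ modulo $p$ is a permutation of $\mathbf{F}_q^2$ if and only if $\gcd(q^4-1,k)=1$.
   Context: Define $\varPhi_{B_2}:\mathbf{C}^2\to\mathbf{C}^2$ by $\varPhi_{B_2}(\sigma,\tau)=\bigl(e^{2\pi i\sigma}+e^{ -2\pi i\sigma}+e^{2\pi i\tau}+e^{ -2\pi i\tau},\ (e^{2\pi i\sigma}+e^{ -2\pi i\sigma})(e^{2\pi i\tau}+e^{ -2\pi i\tau})\bigr)$. For each integer $k\ge 0$, $\mathcal{B}_k:\mathbf{C}^2\to\mathbf{C}^2$ denotes the unique polynomial map (it has integer coefficients) satisfying $\varPhi_{B_2}(k\sigma,k\tau)=\mathcal{B}_k(\varPhi_{B_2}(\sigma,\tau))$ for all $\sigma,\tau\in\mathbf{C}$; e.g. $\mathcal{B}_0=(4,4)$, $\mathcal{B}_1(x,y)=(x,y)$, $\mathcal{B}_2(x,y)=(x^2-2y-4,y^2-2x^2+4y+4)$. This is the family associated with the Lie algebra $B_2\cong C_2$. -}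

module Defs where

open import Level using (Level; _⊔_)
open import Algebra.Bundles using (CommutativeRing)
open import Data.Nat using (ℕ; zero; suc; _^_; _∸_)
open import Data.Nat.Primality using (Prime)
open import Data.Fin using (Fin)
open import Data.Product using (Σ; ∃; _×_; _,_; proj₁; proj₂)
open import Relation.Nullary using (¬_)
open import Relation.Binary.PropositionalEquality using (_≡_)

IsField : ∀ {c ℓ} → CommutativeRing c ℓ → Set (c ⊔ ℓ)
IsField R = (¬ (1# ≈ 0#)) × (∀ x → ¬ (x ≈ 0#) → ∃ λ y → (x * y) ≈ 1#)
  where open CommutativeRing R

HasCardinality : ∀ {c ℓ} → CommutativeRing c ℓ → ℕ → Set (c ⊔ ℓ)
HasCardinality R q =
  Σ (Fin q → Carrier) λ e →
    (∀ i j → e i ≈ e j → i ≡ j) × (∀ x → ∃ λ i → e i ≈ x)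
  where open CommutativeRing R

IsPowerOf : ℕ → ℕ → Set
IsPowerOf p q = ∃ λ n → q ≡ p ^ n

module _ {c ℓ} (R : CommutativeRing c ℓ) where
  open CommutativeRing R

  two three four : Carrier
  two = 1# + 1#
  three = two + 1#
  four = two + two

  Quad : Set c
  Quad = Carrier × Carrier × Carrier × Carrier

  window : Carrier → Carrier → Carrier → Quad → ℕ → Quad
  window e1 e2 e3 init zero = init
  window e1 e2 e3 init (suc k) with window e1 e2 e3 init k
  ... | (s0 , s1 , s2 , s3) =
    (s1 , s2 , s3 , (((e1 * s3) - (e2 * s2)) + (e3 * s1)) - s0)

  -- First component of B_k: power sums of the four roots t^{±1}, u^{±1} of
  --   z^4 - x z^3 + (y+2) z^2 - x z + 1   (where x = a + b, y = a b,
  --   a = t + t⁻¹, b = u + u⁻¹, t = e^{2πiσ}, u = e^{2πiτ}).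
  B₁seq : Carrier → Carrier → ℕ → Carrier
  B₁seq x y k = proj₁ (window x e2 x (four , x , p2 , p3) k)
    where
    e2 = y + two
    p2 = ((x * x) - (two * y)) - four
    p3 = (((x * p2) - (e2 * x)) + (three * x))

  -- Second component of B_k: power sums of the four roots (tu)^{±1}, (t/u)^{±1} of
  --   w^4 - y w^3 + (x^2 - 2y - 2) w^2 - y w + 1.
  B₂seq : Carrier → Carrier → ℕ → Carrier
  B₂seq x y k = proj₁ (window y f2 y (four , y , q2 , q3) k)
    where
    f2 = ((x * x) - (two * y)) - two
    q2 = (y * y) - (two * f2)
    q3 = (((y * q2) - (f2 * y)) + (three * y))

  -- The reduction of 𝓑_k to R (a ring of characteristic p): the integer
  -- polynomial map 𝓑_k evaluated in R.
  𝓑 : ℕ → Carrier × Carrier → Carrier × Carrier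
  𝓑 k (x , y) = (B₁seq x y k , B₂seq x y k)

  _≈²_ : Carrier × Carrier → Carrier × Carrier → Set ℓ
  (a , b) ≈² (c , d) = (a ≈ c) × (b ≈ d)

  IsPermutation : (Carrier × Carrier → Carrier × Carrier) → Set (c ⊔ ℓ)
  IsPermutation f =
    (∀ u v → f u ≈² f v → u ≈² v) × (∀ w → ∃ λ u → f u ≈² w)

-- Every point of F² can be written as Φ (t + t⁻¹) (u + u⁻¹), where Φ a b = (a + b , a b) and
-- t, u lie in an extension of F obtained by three quadratic steps whose coefficients are fixed
-- by the square of the Frobenius σ = (_^ q); hence t and u are fixed by σ⁴, i.e. z ^ (q ^ 4) = z.
-- On such points 𝓑 k acts as (t , u) ↦ (t ^ k , u ^ k), so when k m ≡ 1 modulo q ^ 4 - 1 the map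
-- 𝓑 m inverts 𝓑 k. Conversely, if a prime r divides k and q ^ 4 - 1, take t of order r in the
-- field with q ^ 4 elements. As r divides q ^ 2 - 1 or q ^ 2 + 1, σ² t is t or t⁻¹, so the point
-- Φ (t + t⁻¹) (σ t + σ t⁻¹) is fixed by σ and lies in F²; it differs from (4 , 4) because t ≠ 1,
-- yet 𝓑 k maps both to (4 , 4) because t ^ k = 1.
module Submission where

open import Level using (_⊔_) renaming (suc to lsuc)
open import Algebra.Bundles using (CommutativeRing; RawRing; AbelianGroup)
open import Algebra.Structures using (IsCommutativeRing)
open import Algebra.Morphism.Structures using (module RingMorphisms)
import Algebra.Morphism.Construct.Composition as Composition
import Algebra.Morphism.Construct.Identity as Identity
import Algebra.Construct.DirectProduct as DirectProduct
import Algebra.Properties.CommutativeMonoid.Sum as CommutativeMonoidSum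
import Algebra.Solver.Ring.AlmostCommutativeRing as ACR
open import Data.Nat as ℕ using (ℕ; zero; suc; _≤_; _<_; z≤n; s≤s; _∸_; _!)
import Data.Nat.Properties as ℕ
open import Data.Nat.Tactic.RingSolver using (solve-∀)
open import Data.Nat.Combinatorics using (_C_; nCn≡1; nCk≡n!/k![n-k]!; k![n∸k]!∣n!)
open import Data.Nat.Coprimality using (coprime-Bézout; gcd≡1⇒coprime)
open import Data.Nat.DivMod using (m/n*n≡m)
open import Data.Nat.Divisibility using (_∣_; _∤_; divides; ∣⇒≤; ∣1⇒≡1; m∣m*n; ∣-trans)
open import Data.Nat.GCD using (gcd; module Bézout; gcd[m,n]≢0; gcd[m,n]∣m; gcd[m,n]∣n)
open import Data.Nat.Primality using (Prime; euclidsLemma; prime⇒nonZero; prime⇒nonTrivial)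
open import Data.Nat.Primality.Factorisation using (factorise)
open import Data.Integer as ℤ using (ℤ; -[1+_]; _⊖_)
import Data.Integer.Properties as ℤ
open import Data.Sign as Sign using (Sign)
open import Data.Fin as Fin using (Fin; toℕ; fromℕ; inject₁; punchOut; combine; remQuot)
import Data.Fin.Properties as Fin
open import Data.Fin.Permutation using (Permutation; permutation; _⟨$⟩ʳ_)
open import Data.Vec.Functional using (init; last)
open import Data.List as List using (List; []; _∷_)
import Data.List.Properties as List
open import Data.List.Relation.Unary.All using ([]; _∷_)
open import Data.Maybe using (Maybe; just; nothing)
open import Data.Product using (_×_; _,_; proj₁; proj₂; ∃; ∃₂; Σ)
import Data.Product as Product
open import Data.Product.Relation.Binary.Pointwise.NonDependent using (Pointwise; ×-setoid)
open import Data.Sum as Sum using (_⊎_; inj₁; inj₂; [_,_]′)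
open import Data.Empty using (⊥; ⊥-elim)
open import Function using (_∘_; id)
open import Relation.Nullary using (¬_; Dec; yes; no)
import Relation.Nullary.Decidable as Dec
open import Relation.Binary.Definitions using (Decidable)
open import Relation.Binary.PropositionalEquality as ≡ using (_≡_; _≢_)
open import Defs

open RingMorphisms using (IsRingHomomorphism; IsRingMonomorphism)

-- The ring solver needs coefficients with decidable equality to cancel constants; an arbitrary
-- commutative ring has none, so integers are used, read in R as signed multiples of 1#.
module ℤ-Solver {c ℓ} (R : CommutativeRing c ℓ) where
  open CommutativeRing R
  open import Algebra.Properties.Ring ring using (-0#≈0#; -‿distribˡ-*; -‿distribʳ-*; -‿involutive)
  open import Algebra.Properties.AbelianGroup +-abelianGroup using (⁻¹-∙-comm)
  open import Algebra.Properties.Semiring.Mult.TCOptimised semiring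
    using (×-homo-+; 1+×; ×1-homo-*) renaming (_×_ to _·_)
  open import Relation.Binary.Reasoning.Setoid setoid

  private
    signed : Sign → Carrier → Carrier
    signed Sign.+ x = x
    signed Sign.- x = - x

    ⟦_⟧ℤ : ℤ → Carrier
    ⟦ i ⟧ℤ = signed (ℤ.sign i) (ℤ.∣ i ∣ · 1#)

    signed-cong : ∀ s {x y} → x ≈ y → signed s x ≈ signed s y
    signed-cong Sign.+ x≈y = x≈y
    signed-cong Sign.- x≈y = -‿cong x≈y

    signed-* : ∀ s t x y → signed (s Sign.* t) (x * y) ≈ signed s x * signed t y
    signed-* Sign.+ Sign.+ x y = refl
    signed-* Sign.+ Sign.- x y = -‿distribʳ-* x y
    signed-* Sign.- Sign.+ x y = -‿distribˡ-* x y
    signed-* Sign.- Sign.- x y = begin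
      x * y           ≈⟨ -‿involutive (x * y) ⟨
      - - (x * y)     ≈⟨ -‿cong (-‿distribʳ-* x y) ⟩
      - (x * - y)     ≈⟨ -‿distribˡ-* x (- y) ⟩
      - x * - y       ∎

    ⟦◃⟧ : ∀ s n → ⟦ s ℤ.◃ n ⟧ℤ ≈ signed s (n · 1#)
    ⟦◃⟧ Sign.- zero    = sym -0#≈0#
    ⟦◃⟧ Sign.+ zero    = refl
    ⟦◃⟧ Sign.- (suc n) = refl
    ⟦◃⟧ Sign.+ (suc n) = refl

    *-homo : ∀ i j → ⟦ i ℤ.* j ⟧ℤ ≈ ⟦ i ⟧ℤ * ⟦ j ⟧ℤ
    *-homo i j = begin
      ⟦ i ℤ.* j ⟧ℤ                                      ≈⟨ ⟦◃⟧ (si Sign.* sj) (ℤ.∣ i ∣ ℕ.* ℤ.∣ j ∣) ⟩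
      signed (si Sign.* sj) ((ℤ.∣ i ∣ ℕ.* ℤ.∣ j ∣) · 1#)  ≈⟨ signed-cong (si Sign.* sj) (×1-homo-* ℤ.∣ i ∣ ℤ.∣ j ∣) ⟩
      signed (si Sign.* sj) (_ * _)                      ≈⟨ signed-* si sj _ _ ⟩
      ⟦ i ⟧ℤ * ⟦ j ⟧ℤ                                    ∎
      where
      si sj : Sign
      si = ℤ.sign i
      sj = ℤ.sign j

    ⊖-homo : ∀ m n → ⟦ m ⊖ n ⟧ℤ ≈ m · 1# - n · 1#
    ⊖-homo zero    zero    = sym (-‿inverseʳ 0#)
    ⊖-homo zero    (suc n) = sym (+-identityˡ _)
    ⊖-homo (suc m) zero    = sym (trans (+-congˡ -0#≈0#) (+-identityʳ _))
    ⊖-homo (suc m) (suc n) = begin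
      ⟦ suc m ⊖ suc n ⟧ℤ                 ≡⟨ ≡.cong ⟦_⟧ℤ (ℤ.[1+m]⊖[1+n]≡m⊖n m n) ⟩
      ⟦ m ⊖ n ⟧ℤ                         ≈⟨ ⊖-homo m n ⟩
      m · 1# - n · 1#                    ≈⟨ shift (m · 1#) (n · 1#) ⟩
      (1# + m · 1#) - (1# + n · 1#)      ≈⟨ +-cong (1+× m 1#) (-‿cong (1+× n 1#)) ⟨
      suc m · 1# - suc n · 1#            ∎
      where
      shift : ∀ a b → a - b ≈ (1# + a) - (1# + b)
      shift a b = begin
        a - b                    ≈⟨ +-congˡ (-‿cong (+-identityˡ b)) ⟨
        a - (0# + b)             ≈⟨ +-congˡ (-‿cong (+-congʳ (-‿inverseʳ 1#))) ⟨
        a - ((1# - 1#) + b)      ≈⟨ +-congˡ (-‿cong (+-assoc 1# (- 1#) b)) ⟩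
        a - (1# + (- 1# + b))    ≈⟨ +-congˡ (-‿cong (+-congˡ (+-comm (- 1#) b))) ⟩
        a - (1# + (b - 1#))      ≈⟨ +-congˡ (-‿cong (+-assoc 1# b (- 1#))) ⟨
        a - ((1# + b) - 1#)      ≈⟨ +-congˡ (⁻¹-∙-comm (1# + b) (- 1#)) ⟨
        a + (- (1# + b) + - - 1#) ≈⟨ +-congˡ (+-congˡ (-‿involutive 1#)) ⟩
        a + (- (1# + b) + 1#)    ≈⟨ +-congˡ (+-comm _ 1#) ⟩
        a + (1# - (1# + b))      ≈⟨ +-assoc a 1# _ ⟨
        (a + 1#) - (1# + b)      ≈⟨ +-congʳ (+-comm a 1#) ⟩
        (1# + a) - (1# + b)      ∎

    +-homo : ∀ i j → ⟦ i ℤ.+ j ⟧ℤ ≈ ⟦ i ⟧ℤ + ⟦ j ⟧ℤ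
    +-homo (ℤ.+ m)  (ℤ.+ n)  = ×-homo-+ 1# m n
    +-homo (ℤ.+ m)  -[1+ n ] = ⊖-homo m (suc n)
    +-homo -[1+ m ] (ℤ.+ n)  = trans (⊖-homo n (suc m)) (+-comm _ _)
    +-homo -[1+ m ] -[1+ n ] = begin
      - (suc (suc (m ℕ.+ n)) · 1#)          ≡⟨ ≡.cong (λ k → - (k · 1#)) (ℕ.+-suc (suc m) n) ⟨
      - ((suc m ℕ.+ suc n) · 1#)            ≈⟨ -‿cong (×-homo-+ 1# (suc m) (suc n)) ⟩
      - (suc m · 1# + suc n · 1#)           ≈⟨ ⁻¹-∙-comm _ _ ⟨
      - (suc m · 1#) + - (suc n · 1#)       ∎

    -‿homo : ∀ i → ⟦ ℤ.- i ⟧ℤ ≈ - ⟦ i ⟧ℤ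
    -‿homo (ℤ.+ zero)  = sym -0#≈0#
    -‿homo (ℤ.+ suc n) = refl
    -‿homo -[1+ n ]    = sym (-‿involutive _)

    ℤ-rawRing : RawRing _ _
    ℤ-rawRing = record
      { Carrier = ℤ ; _≈_ = _≡_ ; _+_ = ℤ._+_ ; _*_ = ℤ._*_ ; -_ = ℤ.-_ ; 0# = ℤ.+ 0 ; 1# = ℤ.+ 1 }

    ℤ⟶R : ℤ-rawRing ACR.-Raw-AlmostCommutative⟶ ACR.fromCommutativeRing R
    ℤ⟶R = record
      { ⟦_⟧ = ⟦_⟧ℤ ; +-homo = +-homo ; *-homo = *-homo ; -‿homo = -‿homo ; 0-homo = refl ; 1-homo = refl }

    ⟦⟧ℤ-weaklyInjective : ∀ i j → Maybe (⟦ i ⟧ℤ ≈ ⟦ j ⟧ℤ)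
    ⟦⟧ℤ-weaklyInjective i j with i ℤ.≟ j
    ... | yes ≡.refl = just refl
    ... | no _       = nothing

  open import Algebra.Solver.Ring ℤ-rawRing (ACR.fromCommutativeRing R) ℤ⟶R ⟦⟧ℤ-weaklyInjective public
    using (Polynomial; solve; _:=_; _:+_; _:*_; _:-_; :-_; con)

  :zero :one :two :three :four : ∀ {n} → Polynomial n
  :zero  = con (ℤ.+ 0)
  :one   = con (ℤ.+ 1)
  :two   = con (ℤ.+ 2)
  :three = :two :+ :one
  :four  = :two :+ :two

module RingProperties {c ℓ} (R : CommutativeRing c ℓ) where
  open CommutativeRing R
  open import Algebra.Properties.Ring ring using (-0#≈0#)
  open ℤ-Solver R
  open import Algebra.Properties.Semiring.Exp semiring using (_^_; ^-congˡ; ^-homo-*; ^-assocʳ)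
  open import Relation.Binary.Reasoning.Setoid setoid
  open import Algebra.Properties.CommutativeSemiring.Exp commutativeSemiring using (^-distrib-*)
  open import Algebra.Properties.CommutativeSemigroup *-commutativeSemigroup using (interchange)

  ≈-modulo : ∀ {x y w z} → z ≈ 0# → x ≈ y + w * z → x ≈ y
  ≈-modulo {x} {y} {w} {z} z≈0 x≈y+wz =
    trans x≈y+wz (trans (+-congˡ (trans (*-congˡ z≈0) (zeroʳ w))) (+-identityʳ y))

  *-preserves-inverses : ∀ {x x′ y y′} → x * x′ ≈ 1# → y * y′ ≈ 1# → (x * y) * (x′ * y′) ≈ 1#
  *-preserves-inverses {x} {x′} {y} {y′} xx′≈1 yy′≈1 =
    trans (interchange x y x′ y′) (trans (*-cong xx′≈1 yy′≈1) (*-identityˡ 1#))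

  1^n≈1 : ∀ n → 1# ^ n ≈ 1#
  1^n≈1 zero    = refl
  1^n≈1 (suc n) = trans (*-identityˡ _) (1^n≈1 n)

  x*y≈1⇒xⁿ*yⁿ≈1 : ∀ {x y} → x * y ≈ 1# → ∀ n → x ^ n * y ^ n ≈ 1#
  x*y≈1⇒xⁿ*yⁿ≈1 {x} {y} xy≈1 n = trans (sym (^-distrib-* x y n)) (trans (^-congˡ n xy≈1) (1^n≈1 n))

  x^[1+m]≈x⇒x^[1+j*m]≈x : ∀ {x m} → x ^ suc m ≈ x → ∀ j → x ^ suc (j ℕ.* m) ≈ x
  x^[1+m]≈x⇒x^[1+j*m]≈x {x} {m} x^[1+m]≈x zero    = *-identityʳ x
  x^[1+m]≈x⇒x^[1+j*m]≈x {x} {m} x^[1+m]≈x (suc j) = begin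
    x ^ suc (m ℕ.+ j ℕ.* m)       ≡⟨ ≡.cong (x ^_) (ℕ.+-suc m (j ℕ.* m)) ⟨
    x ^ (m ℕ.+ suc (j ℕ.* m))     ≈⟨ ^-homo-* x m (suc (j ℕ.* m)) ⟩
    x ^ m * x ^ suc (j ℕ.* m)     ≈⟨ *-congˡ (x^[1+m]≈x⇒x^[1+j*m]≈x x^[1+m]≈x j) ⟩
    x ^ m * x                     ≈⟨ *-comm (x ^ m) x ⟩
    x ^ suc m                     ≈⟨ x^[1+m]≈x ⟩
    x                             ∎

  x^r≈1⇒x^[e*r]≈1 : ∀ {x r} → x ^ r ≈ 1# → ∀ e → x ^ (e ℕ.* r) ≈ 1#
  x^r≈1⇒x^[e*r]≈1 {x} {r} x^r≈1 e = begin
    x ^ (e ℕ.* r)    ≡⟨ ≡.cong (x ^_) (ℕ.*-comm e r) ⟩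
    x ^ (r ℕ.* e)    ≈⟨ ^-assocʳ x r e ⟨
    (x ^ r) ^ e      ≈⟨ ^-congˡ e x^r≈1 ⟩
    1# ^ e           ≈⟨ 1^n≈1 e ⟩
    1#               ∎

  quadratic : (s n z : Carrier) → Carrier
  quadratic s n z = z * z - s * z + n

  quadratic-cong : ∀ {s n z s′ n′ z′} → s ≈ s′ → n ≈ n′ → z ≈ z′ → quadratic s n z ≈ quadratic s′ n′ z′
  quadratic-cong s≈ n≈ z≈ = +-cong (+-cong (*-cong z≈ z≈) (-‿cong (*-cong s≈ z≈))) n≈

  quadratic≈0⇒s*z≈z*z+n : ∀ {s n z} → quadratic s n z ≈ 0# → s * z ≈ z * z + n
  quadratic≈0⇒s*z≈z*z+n {s} {n} {z} q≈0 =
    trans (solve 3 (λ s n z → s :* z := z :* z :+ n :- (z :* z :- s :* z :+ n)) refl s n z)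
          (trans (+-congˡ (trans (-‿cong q≈0) (-0#≈0#))) (+-identityʳ _))

  quadratic≈0⇒z*[s-z]≈n : ∀ {s n z} → quadratic s n z ≈ 0# → z * (s - z) ≈ n
  quadratic≈0⇒z*[s-z]≈n {s} {n} {z} q≈0 =
    trans (solve 3 (λ s n z → z :* (s :- z) := n :- (z :* z :- s :* z :+ n)) refl s n z)
          (trans (+-congˡ (trans (-‿cong q≈0) (-0#≈0#))) (+-identityʳ n))

  quadratic-conjugate : ∀ s n z → quadratic s n (s - z) ≈ quadratic s n z
  quadratic-conjugate s n z =
    solve 3 (λ s n z → (s :- z) :* (s :- z) :- s :* (s :- z) :+ n := z :* z :- s :* z :+ n) refl s n z

module Window {c ℓ} (R : CommutativeRing c ℓ) where
  open CommutativeRing R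

  infix 4 _≈₄_
  _≈₄_ : Quad R → Quad R → Set ℓ
  (a₀ , a₁ , a₂ , a₃) ≈₄ (b₀ , b₁ , b₂ , b₃) = a₀ ≈ b₀ × a₁ ≈ b₁ × a₂ ≈ b₂ × a₃ ≈ b₃

  next : (e₁ e₂ e₃ s₀ s₁ s₂ s₃ : Carrier) → Carrier
  next e₁ e₂ e₃ s₀ s₁ s₂ s₃ = e₁ * s₃ - e₂ * s₂ + e₃ * s₁ - s₀

  next-cong : ∀ {e₁ e₂ e₃ s₀ s₁ s₂ s₃ e₁′ e₂′ e₃′ s₀′ s₁′ s₂′ s₃′} →
              e₁ ≈ e₁′ → e₂ ≈ e₂′ → e₃ ≈ e₃′ → s₀ ≈ s₀′ → s₁ ≈ s₁′ → s₂ ≈ s₂′ → s₃ ≈ s₃′ →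
              next e₁ e₂ e₃ s₀ s₁ s₂ s₃ ≈ next e₁′ e₂′ e₃′ s₀′ s₁′ s₂′ s₃′
  next-cong ≈₁ ≈₂ ≈₃ ≈s₀ ≈s₁ ≈s₂ ≈s₃ =
    +-cong (+-cong (+-cong (*-cong ≈₁ ≈s₃) (-‿cong (*-cong ≈₂ ≈s₂))) (*-cong ≈₃ ≈s₁)) (-‿cong ≈s₀)

  window-≈ : ∀ {e₁ e₂ e₃ i} (s : ℕ → Carrier) →
             (∀ j → s (4 ℕ.+ j) ≈ next e₁ e₂ e₃ (s j) (s (1 ℕ.+ j)) (s (2 ℕ.+ j)) (s (3 ℕ.+ j))) →
             i ≈₄ (s 0 , s 1 , s 2 , s 3) →
             ∀ k → window R e₁ e₂ e₃ i k ≈₄ (s k , s (1 ℕ.+ k) , s (2 ℕ.+ k) , s (3 ℕ.+ k))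
  window-≈ s rec i≈ zero    = i≈
  window-≈ s rec i≈ (suc k) with window-≈ s rec i≈ k
  ... | ≈₀ , ≈₁ , ≈₂ , ≈₃ =
    ≈₁ , ≈₂ , ≈₃ , trans (next-cong refl refl refl ≈₀ ≈₁ ≈₂ ≈₃) (sym (rec k))

module HomomorphismProperties
  {c₁ ℓ₁ c₂ ℓ₂} {R : CommutativeRing c₁ ℓ₁} {S : CommutativeRing c₂ ℓ₂}
  {f : CommutativeRing.Carrier R → CommutativeRing.Carrier S}
  (f-homo : RingMorphisms.IsRingHomomorphism (CommutativeRing.rawRing R) (CommutativeRing.rawRing S) f)
  where
  private module R = CommutativeRing R
  open CommutativeRing S
  open RingMorphisms.IsRingHomomorphism f-homo public
  open import Algebra.Properties.Semiring.Mult semiring using () renaming (_×_ to _·_)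
  open import Algebra.Properties.Semiring.Mult R.semiring using () renaming (_×_ to _·ᴿ_)
  open import Algebra.Properties.Semiring.Exp semiring using (_^_)
  open import Algebra.Properties.Semiring.Exp R.semiring using () renaming (_^_ to _^ᴿ_)

  minus-homo : ∀ x y → f (x R.- y) ≈ f x - f y
  minus-homo x y = trans (+-homo x (R.- y)) (+-congˡ (-‿homo y))

  homo-+ : ∀ {a b a′ b′} → f a ≈ a′ → f b ≈ b′ → f (a R.+ b) ≈ a′ + b′
  homo-+ a≈ b≈ = trans (+-homo _ _) (+-cong a≈ b≈)

  homo-minus : ∀ {a b a′ b′} → f a ≈ a′ → f b ≈ b′ → f (a R.- b) ≈ a′ - b′
  homo-minus a≈ b≈ = trans (minus-homo _ _) (+-cong a≈ (-‿cong b≈))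

  homo-* : ∀ {a b a′ b′} → f a ≈ a′ → f b ≈ b′ → f (a R.* b) ≈ a′ * b′
  homo-* a≈ b≈ = trans (*-homo _ _) (*-cong a≈ b≈)

  two-homo : f (two R) ≈ two S
  two-homo = homo-+ 1#-homo 1#-homo

  three-homo : f (three R) ≈ three S
  three-homo = homo-+ two-homo 1#-homo

  four-homo : f (four R) ≈ four S
  four-homo = homo-+ two-homo two-homo

  ·-homo : ∀ m x → f (m ·ᴿ x) ≈ m · f x
  ·-homo zero    x = 0#-homo
  ·-homo (suc m) x = homo-+ refl (·-homo m x)

  ^-homo : ∀ x m → f (x ^ᴿ m) ≈ f x ^ m
  ^-homo x zero    = 1#-homo
  ^-homo x (suc m) = homo-* refl (^-homo x m)

  quadratic-root-homo : ∀ {s n z s′ n′} → f s ≈ s′ → f n ≈ n′ → RingProperties.quadratic R s n z R.≈ R.0# →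
                        RingProperties.quadratic S s′ n′ (f z) ≈ 0#
  quadratic-root-homo fs≈ fn≈ root =
    trans (sym (homo-+ (homo-minus (homo-* refl refl) (homo-* fs≈ refl)) fn≈)) (trans (⟦⟧-cong root) 0#-homo)

module _ {c₁ ℓ₁ c₂ ℓ₂} {R : CommutativeRing c₁ ℓ₁} {S : CommutativeRing c₂ ℓ₂} where
  private
    module R = CommutativeRing R
  open CommutativeRing S
  open import Algebra.Properties.Ring ring using (x+x≈x⇒x≈0; +-inverseʳ-unique)

  mkIsRingHomomorphism : (f : R.Carrier → Carrier) → (∀ {x y} → x R.≈ y → f x ≈ f y) →
                         (∀ x y → f (x R.+ y) ≈ f x + f y) → (∀ x y → f (x R.* y) ≈ f x * f y) → f R.1# ≈ 1# →
                         IsRingHomomorphism R.rawRing rawRing f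
  mkIsRingHomomorphism f f-cong +-homo *-homo 1-homo = record
    { isSemiringHomomorphism = record
      { isNearSemiringHomomorphism = record
        { +-isMonoidHomomorphism = record
          { isMagmaHomomorphism = record { isRelHomomorphism = record { cong = f-cong } ; homo = +-homo }
          ; ε-homo = 0-homo }
        ; *-homo = *-homo }
      ; 1#-homo = 1-homo }
    ; -‿homo = λ x → +-inverseʳ-unique (f x) (f (R.- x))
                       (trans (sym (+-homo x (R.- x))) (trans (f-cong (R.-‿inverseʳ x)) 0-homo)) }
    where
    0-homo : f R.0# ≈ 0#
    0-homo = x+x≈x⇒x≈0 (f R.0#) (trans (sym (+-homo R.0# R.0#)) (f-cong (R.+-identityʳ R.0#)))

module WindowHomomorphism
  {c₁ ℓ₁ c₂ ℓ₂} {R : CommutativeRing c₁ ℓ₁} {S : CommutativeRing c₂ ℓ₂}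
  {f : CommutativeRing.Carrier R → CommutativeRing.Carrier S}
  (f-homo : RingMorphisms.IsRingHomomorphism (CommutativeRing.rawRing R) (CommutativeRing.rawRing S) f)
  where
  private module R = CommutativeRing R
  open CommutativeRing S
  open HomomorphismProperties {R = R} {S = S} f-homo
  open Window S

  map₄ : Quad R → Quad S
  map₄ (a₀ , a₁ , a₂ , a₃) = f a₀ , f a₁ , f a₂ , f a₃

  next-homo : ∀ e₁ e₂ e₃ s₀ s₁ s₂ s₃ →
              f (Window.next R e₁ e₂ e₃ s₀ s₁ s₂ s₃) ≈ next (f e₁) (f e₂) (f e₃) (f s₀) (f s₁) (f s₂) (f s₃)
  next-homo e₁ e₂ e₃ s₀ s₁ s₂ s₃ =
    homo-minus (homo-+ (homo-minus (*-homo e₁ s₃) (*-homo e₂ s₂)) (*-homo e₃ s₁)) refl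

  window-homo : ∀ {e₁ e₂ e₃ i e₁′ e₂′ e₃′ i′} → f e₁ ≈ e₁′ → f e₂ ≈ e₂′ → f e₃ ≈ e₃′ → map₄ i ≈₄ i′ →
                ∀ k → map₄ (window R e₁ e₂ e₃ i k) ≈₄ window S e₁′ e₂′ e₃′ i′ k
  window-homo ≈₁ ≈₂ ≈₃ i≈ zero = i≈
  window-homo ≈₁ ≈₂ ≈₃ i≈ (suc k) with window-homo ≈₁ ≈₂ ≈₃ i≈ k
  ... | h₀ , h₁ , h₂ , h₃ = h₁ , h₂ , h₃ , trans (next-homo _ _ _ _ _ _ _) (next-cong ≈₁ ≈₂ ≈₃ h₀ h₁ h₂ h₃)

  B₁seq-homo : ∀ {x y x′ y′} → f x ≈ x′ → f y ≈ y′ → ∀ k → f (B₁seq R x y k) ≈ B₁seq S x′ y′ k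
  B₁seq-homo {x} {y} {x′} {y′} fx≈ fy≈ k =
    proj₁ (window-homo fx≈ e₂≈ fx≈ (four-homo , fx≈ , p₂≈ ,
                                     homo-+ (homo-minus (homo-* fx≈ p₂≈) (homo-* e₂≈ fx≈)) (homo-* three-homo fx≈)) k)
    where
    e₂≈ : f (y R.+ two R) ≈ y′ + two S
    e₂≈ = homo-+ fy≈ two-homo
    p₂≈ : f (x R.* x R.- two R R.* y R.- four R) ≈ x′ * x′ - two S * y′ - four S
    p₂≈ = homo-minus (homo-minus (homo-* fx≈ fx≈) (homo-* two-homo fy≈)) four-homo

module Lucas {c ℓ} (R : CommutativeRing c ℓ) where
  open CommutativeRing R
  open ℤ-Solver R
  open Window R
  open RingProperties R
  open import Relation.Binary.Reasoning.Setoid setoid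
  open import Algebra.Properties.CommutativeSemiring.Exp commutativeSemiring using (^-distrib-*)
  open import Algebra.Properties.Group +-group using () renaming (x≈y⇒x∙y⁻¹≈ε to x≈y⇒x-y≈0)
  open WindowHomomorphism {R = R} {S = R} (Identity.isRingHomomorphism rawRing refl)
  open import Algebra.Properties.Semiring.Exp semiring using (_^_)

  lucas : Carrier → ℕ → Carrier
  lucas a zero          = two R
  lucas a (suc zero)    = a
  lucas a (suc (suc j)) = a * lucas a (suc j) - lucas a j

  B₁seq-lucas : ∀ a b k → B₁seq R (a + b) (a * b) k ≈ lucas a k + lucas b k
  B₁seq-lucas a b k = proj₁ (window-≈ s recurrence (refl , refl , initial₂ , initial₃) k)
    where
    s : ℕ → Carrier
    s j = lucas a j + lucas b j
    recurrence : ∀ j → s (4 ℕ.+ j) ≈ next (a + b) (a * b + two R) (a + b)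
                                          (s j) (s (1 ℕ.+ j)) (s (2 ℕ.+ j)) (s (3 ℕ.+ j))
    recurrence j = solve 6 (λ a b A₀ A₁ B₀ B₁ →
      let A₂ = a :* A₁ :- A₀ ; A₃ = a :* A₂ :- A₁ ; B₂ = b :* B₁ :- B₀ ; B₃ = b :* B₂ :- B₁ in
      (a :* A₃ :- A₂) :+ (b :* B₃ :- B₂)
        := (a :+ b) :* (A₃ :+ B₃) :- (a :* b :+ :two) :* (A₂ :+ B₂) :+ (a :+ b) :* (A₁ :+ B₁) :- (A₀ :+ B₀))
      refl a b (lucas a j) (lucas a (suc j)) (lucas b j) (lucas b (suc j))
    initial₂ : (a + b) * (a + b) - two R * (a * b) - four R ≈ s 2
    initial₂ = solve 2 (λ a b → (a :+ b) :* (a :+ b) :- :two :* (a :* b) :- :four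
                                 := (a :* a :- :two) :+ (b :* b :- :two)) refl a b
    initial₃ : (a + b) * ((a + b) * (a + b) - two R * (a * b) - four R) - (a * b + two R) * (a + b) + three R * (a + b)
               ≈ s 3
    initial₃ = solve 2 (λ a b →
      let x = a :+ b ; y = a :* b in
      x :* (x :* x :- :two :* y :- :four) :- (y :+ :two) :* x :+ :three :* x
        := (a :* (a :* a :- :two) :- a) :+ (b :* (b :* b :- :two) :- b)) refl a b

  B₂seq≈B₁seq : ∀ x y k → B₂seq R x y k ≈ B₁seq R y (x * x - two R * y - four R) k
  B₂seq≈B₁seq x y k = proj₁ (window-homo refl e₂≈ refl (refl , refl , q₂≈ , q₃≈) k)
    where
    e₂≈ : x * x - two R * y - two R ≈ (x * x - two R * y - four R) + two R
    e₂≈ = solve 2 (λ x y → x :* x :- :two :* y :- :two := (x :* x :- :two :* y :- :four) :+ :two) refl x y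
    q₂≈ : y * y - two R * (x * x - two R * y - two R) ≈ y * y - two R * (x * x - two R * y - four R) - four R
    q₂≈ = solve 2 (λ x y → y :* y :- :two :* (x :* x :- :two :* y :- :two)
                           := y :* y :- :two :* (x :* x :- :two :* y :- :four) :- :four) refl x y
    q₃≈ : y * (y * y - two R * (x * x - two R * y - two R)) - (x * x - two R * y - two R) * y + three R * y
          ≈ y * (y * y - two R * (x * x - two R * y - four R) - four R)
              - ((x * x - two R * y - four R) + two R) * y + three R * y
    q₃≈ = solve 2 (λ x y →
      let f₂ = x :* x :- :two :* y :- :two ; y′ = x :* x :- :two :* y :- :four in
      y :* (y :* y :- :two :* f₂) :- f₂ :* y :+ :three :* y
        := y :* (y :* y :- :two :* y′ :- :four) :- (y′ :+ :two) :* y :+ :three :* y) refl x y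

  lucas-powers : ∀ {t t′} → t * t′ ≈ 1# → ∀ j → lucas (t + t′) j ≈ t ^ j + t′ ^ j
  lucas-powers tt′≈1 zero          = refl
  lucas-powers tt′≈1 (suc zero)    = sym (+-cong (*-identityʳ _) (*-identityʳ _))
  lucas-powers {t} {t′} tt′≈1 (suc (suc j)) = begin
    (t + t′) * lucas (t + t′) (suc j) - lucas (t + t′) j
      ≈⟨ +-cong (*-congˡ (lucas-powers tt′≈1 (suc j))) (-‿cong (lucas-powers tt′≈1 j)) ⟩
    (t + t′) * (t * t ^ j + t′ * t′ ^ j) - (t ^ j + t′ ^ j)
      ≈⟨ ≈-modulo (x≈y⇒x-y≈0 tt′≈1) (solve 4 (λ t t′ T T′ →
           (t :+ t′) :* (t :* T :+ t′ :* T′) :- (T :+ T′)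
             := t :* (t :* T) :+ t′ :* (t′ :* T′) :+ (T :+ T′) :* (t :* t′ :- :one)) refl t t′ (t ^ j) (t′ ^ j)) ⟩
    t * (t * t ^ j) + t′ * (t′ * t′ ^ j) ∎

  B₁seq-cong : ∀ {x y x′ y′} → x ≈ x′ → y ≈ y′ → ∀ k → B₁seq R x y k ≈ B₁seq R x′ y′ k
  B₁seq-cong = B₁seq-homo

  -- Φ (t + t⁻¹) (u + u⁻¹) is the paper's Φ_{B₂} (σ , τ) for t = e^{2πiσ}, u = e^{2πiτ}.
  Φ : Carrier → Carrier → Carrier × Carrier
  Φ a b = a + b , a * b

  𝓑-Φ : ∀ {t t′ u u′} → t * t′ ≈ 1# → u * u′ ≈ 1# →
        ∀ k → _≈²_ R (𝓑 R k (Φ (t + t′) (u + u′))) (Φ (t ^ k + t′ ^ k) (u ^ k + u′ ^ k))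
  -- For the second coordinate, γ and δ play the role of a and b: γ + δ = a b and
  -- γ δ = (a + b)² - 2 a b - 4, the arguments at which B₂ is B₁.
  𝓑-Φ {t} {t′} {u} {u′} tt′≈1 uu′≈1 k =
    trans (B₁seq-lucas a b k) (+-cong (lucas-powers tt′≈1 k) (lucas-powers uu′≈1 k)) ,
    (begin
      B₂seq R (a + b) (a * b) k
        ≈⟨ B₂seq≈B₁seq (a + b) (a * b) k ⟩
      B₁seq R (a * b) ((a + b) * (a + b) - two R * (a * b) - four R) k
        ≈⟨ B₁seq-cong ab≈γ+δ [a+b]²-2ab-4≈γδ k ⟩
      B₁seq R (γ + δ) (γ * δ) k
        ≈⟨ B₁seq-lucas γ δ k ⟩
      lucas γ k + lucas δ k
        ≈⟨ +-cong (lucas-powers (*-preserves-inverses tt′≈1 uu′≈1) k)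
                  (lucas-powers (*-preserves-inverses tt′≈1 (trans (*-comm u′ u) uu′≈1)) k) ⟩
      ((t * u) ^ k + (t′ * u′) ^ k) + ((t * u′) ^ k + (t′ * u) ^ k)
        ≈⟨ +-cong (+-cong (^-distrib-* t u k) (^-distrib-* t′ u′ k))
                  (+-cong (^-distrib-* t u′ k) (^-distrib-* t′ u k)) ⟩
      (t ^ k * u ^ k + t′ ^ k * u′ ^ k) + (t ^ k * u′ ^ k + t′ ^ k * u ^ k)
        ≈⟨ solve 4 (λ T T′ U U′ → (T :* U :+ T′ :* U′) :+ (T :* U′ :+ T′ :* U) := (T :+ T′) :* (U :+ U′))
                   refl (t ^ k) (t′ ^ k) (u ^ k) (u′ ^ k) ⟩
      (t ^ k + t′ ^ k) * (u ^ k + u′ ^ k) ∎)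
    where
    a b γ δ : Carrier
    a = t + t′
    b = u + u′
    γ = t * u + t′ * u′
    δ = t * u′ + t′ * u
    ab≈γ+δ : a * b ≈ γ + δ
    ab≈γ+δ = solve 4 (λ t t′ u u′ → (t :+ t′) :* (u :+ u′) := (t :* u :+ t′ :* u′) :+ (t :* u′ :+ t′ :* u))
                     refl t t′ u u′
    [a+b]²-2ab-4≈γδ : (a + b) * (a + b) - two R * (a * b) - four R ≈ γ * δ
    [a+b]²-2ab-4≈γδ = ≈-modulo (x≈y⇒x-y≈0 tt′≈1) (≈-modulo (x≈y⇒x-y≈0 uu′≈1) (solve 4 (λ t t′ u u′ →
      let a = t :+ t′ ; b = u :+ u′ in
      (a :+ b) :* (a :+ b) :- :two :* (a :* b) :- :four
        := (t :* u :+ t′ :* u′) :* (t :* u′ :+ t′ :* u)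
           :+ (:two :- u :* u :- u′ :* u′) :* (t :* t′ :- :one)
           :+ (:two :- t :* t :- t′ :* t′) :* (u :* u′ :- :one)) refl t t′ u u′))

module _ {c₁ ℓ₁ c₂ ℓ₂} {R : CommutativeRing c₁ ℓ₁} {S : CommutativeRing c₂ ℓ₂}
  {f : CommutativeRing.Carrier R → CommutativeRing.Carrier S}
  (f-homo : RingMorphisms.IsRingHomomorphism (CommutativeRing.rawRing R) (CommutativeRing.rawRing S) f)
  where
  private module R = CommutativeRing R
  open CommutativeRing S
  open HomomorphismProperties {R = R} {S = S} f-homo using (⟦⟧-cong; homo-minus; homo-*; two-homo; four-homo)
  open WindowHomomorphism {R = R} {S = S} f-homo
  open import Relation.Binary.Reasoning.Setoid setoid

  𝓑-homo : ∀ {w w′} → _≈²_ S (Product.map f f w) w′ →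
           ∀ k → _≈²_ S (Product.map f f (𝓑 R k w)) (𝓑 S k w′)
  𝓑-homo {x , y} {x′ , y′} (fx≈ , fy≈) k = B₁seq-homo fx≈ fy≈ k , (begin
    f (B₂seq R x y k)                                        ≈⟨ ⟦⟧-cong (Lucas.B₂seq≈B₁seq R x y k) ⟩
    f (B₁seq R y (x R.* x R.- two R R.* y R.- four R) k)     ≈⟨ B₁seq-homo fy≈ y″≈ k ⟩
    B₁seq S y′ (x′ * x′ - two S * y′ - four S) k             ≈⟨ Lucas.B₂seq≈B₁seq S x′ y′ k ⟨
    B₂seq S x′ y′ k                                          ∎)
    where
    y″≈ : f (x R.* x R.- two R R.* y R.- four R) ≈ x′ * x′ - two S * y′ - four S
    y″≈ = homo-minus (homo-minus (homo-* fx≈ fx≈) (homo-* two-homo fy≈)) four-homo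

module _ {c ℓ} (R : CommutativeRing c ℓ) where
  open CommutativeRing R
  open RingProperties R
  open Lucas R using (Φ; 𝓑-Φ)
  open import Algebra.Properties.Semiring.Exp semiring using (_^_; ^-assocʳ)
  open import Relation.Binary.Reasoning.Setoid (×-setoid setoid setoid)

  𝓑-cong : ∀ {w w′} → _≈²_ R w w′ → ∀ k → _≈²_ R (𝓑 R k w) (𝓑 R k w′)
  𝓑-cong = 𝓑-homo {R = R} {S = R} (Identity.isRingHomomorphism rawRing refl)

  Φ-cong : ∀ {a b a′ b′} → a ≈ a′ → b ≈ b′ → _≈²_ R (Φ a b) (Φ a′ b′)
  Φ-cong a≈ b≈ = +-cong a≈ b≈ , *-cong a≈ b≈

  𝓑∘𝓑-Φ : ∀ {t t′ u u′} → t * t′ ≈ 1# → u * u′ ≈ 1# → ∀ k m →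
          _≈²_ R (𝓑 R m (𝓑 R k (Φ (t + t′) (u + u′))))
                 (Φ (t ^ (k ℕ.* m) + t′ ^ (k ℕ.* m)) (u ^ (k ℕ.* m) + u′ ^ (k ℕ.* m)))
  𝓑∘𝓑-Φ {t} {t′} {u} {u′} tt′≈1 uu′≈1 k m = begin
    𝓑 R m (𝓑 R k (Φ (t + t′) (u + u′)))
      ≈⟨ 𝓑-cong (𝓑-Φ tt′≈1 uu′≈1 k) m ⟩
    𝓑 R m (Φ (t ^ k + t′ ^ k) (u ^ k + u′ ^ k))
      ≈⟨ 𝓑-Φ (x*y≈1⇒xⁿ*yⁿ≈1 tt′≈1 k) (x*y≈1⇒xⁿ*yⁿ≈1 uu′≈1 k) m ⟩
    Φ ((t ^ k) ^ m + (t′ ^ k) ^ m) ((u ^ k) ^ m + (u′ ^ k) ^ m)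
      ≈⟨ Φ-cong (+-cong (^-assocʳ t k m) (^-assocʳ t′ k m)) (+-cong (^-assocʳ u k m) (^-assocʳ u′ k m)) ⟩
    Φ (t ^ (k ℕ.* m) + t′ ^ (k ℕ.* m)) (u ^ (k ℕ.* m) + u′ ^ (k ℕ.* m)) ∎

prime⇒2≤ : ∀ {p} → Prime p → 2 ≤ p
prime⇒2≤ {p} p-prime = ℕ.nonTrivial⇒n>1 p {{prime⇒nonTrivial p-prime}}

prime∤m! : ∀ {p m} → Prime p → m < p → p ∤ m !
prime∤m! {p} {zero}  p-prime m<p p∣1 = ℕ.<-irrefl (≡.sym (∣1⇒≡1 p∣1)) (prime⇒2≤ p-prime)
prime∤m! {p} {suc m} p-prime m<p p∣m! with euclidsLemma (suc m) (m !) p-prime p∣m!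
... | inj₁ p∣1+m = ℕ.<⇒≱ m<p (∣⇒≤ p∣1+m)
... | inj₂ p∣m!  = prime∤m! p-prime (ℕ.<-trans (ℕ.n<1+n m) m<p) p∣m!

prime∣pCk : ∀ {p k} → Prime p → 0 < k → k < p → p ∣ p C k
prime∣pCk {p} {k} p-prime 0<k k<p
  with euclidsLemma (p C k) (k ! ℕ.* (p ∸ k) !) p-prime (≡.subst (p ∣_) (≡.sym pCk*k!*[p-k]!≡p!) p∣p!)
  where
  instance _ = ℕ._!*_!≢0 k (p ∸ k)
  pCk*k!*[p-k]!≡p! : (p C k) ℕ.* (k ! ℕ.* (p ∸ k) !) ≡ p !
  pCk*k!*[p-k]!≡p! = ≡.trans (≡.cong (ℕ._* (k ! ℕ.* (p ∸ k) !)) (nCk≡n!/k![n-k]! (ℕ.<⇒≤ k<p)))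
                             (m/n*n≡m (k![n∸k]!∣n! (ℕ.<⇒≤ k<p)))
  p∣p! : p ∣ p !
  p∣p! with prime⇒2≤ p-prime
  ... | s≤s _ = m∣m*n _
... | inj₁ p∣pCk = p∣pCk
... | inj₂ p∣k!*[p-k]! with euclidsLemma (k !) ((p ∸ k) !) p-prime p∣k!*[p-k]!
...   | inj₁ p∣k!      = ⊥-elim (prime∤m! p-prime k<p p∣k!)
...   | inj₂ p∣[p-k]!  = ⊥-elim (prime∤m! p-prime (ℕ.∸-monoʳ-< 0<k (ℕ.<⇒≤ k<p)) p∣[p-k]!)

∃-inverse-mod : ∀ {M k} → 2 ≤ M → gcd M k ≡ 1 → ∃₂ λ m j → k ℕ.* m ≡ suc (j ℕ.* M)
∃-inverse-mod {suc (suc w)} {k} (s≤s (s≤s _)) gcd≡1 with coprime-Bézout (gcd≡1⇒coprime gcd≡1)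
... | Bézout.-+ x y 1+xM≡yk = y , x , ≡.trans (ℕ.*-comm k y) (≡.sym 1+xM≡yk)
... | Bézout.+- zero y 1+yk≡0 = ⊥-elim (ℕ.1+n≢0 1+yk≡0)
... | Bézout.+- (suc x) y 1+yk≡[1+x]M = y ℕ.* suc w , x ℕ.* suc w ℕ.+ w , (begin
  k ℕ.* (y ℕ.* suc w)                       ≡⟨ ℕ.*-assoc k y (suc w) ⟨
  k ℕ.* y ℕ.* suc w                         ≡⟨ ≡.cong (ℕ._* suc w) (ℕ.*-comm k y) ⟩
  y ℕ.* k ℕ.* suc w                         ≡⟨ ≡.cong (ℕ._* suc w) (ℕ.suc-injective 1+yk≡[1+x]M) ⟩
  (suc w ℕ.+ x ℕ.* suc (suc w)) ℕ.* suc w   ≡⟨ identity x w ⟩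
  suc ((x ℕ.* suc w ℕ.+ w) ℕ.* suc (suc w)) ∎)
  where
  open ≡.≡-Reasoning
  identity : ∀ x w → (1 ℕ.+ w ℕ.+ x ℕ.* (2 ℕ.+ w)) ℕ.* (1 ℕ.+ w) ≡ 1 ℕ.+ (x ℕ.* (1 ℕ.+ w) ℕ.+ w) ℕ.* (2 ℕ.+ w)
  identity = solve-∀

∃-common-prime-factor : ∀ m n → m ≢ 0 → gcd m n ≢ 1 → ∃ λ r → Prime r × r ∣ m × r ∣ n
∃-common-prime-factor m n m≢0 gcd≢1 with factorise (gcd m n) {{ℕ.≢-nonZero (gcd[m,n]≢0 m n (inj₁ m≢0))}}
... | record { factors = [] ; isFactorisation = gcd≡1 } = ⊥-elim (gcd≢1 gcd≡1)
... | record { factors = r ∷ rs ; isFactorisation = gcd≡r*∏rs ; factorsPrime = r-prime ∷ _ } =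
  r , r-prime , ∣-trans r∣gcd (gcd[m,n]∣m m n) , ∣-trans r∣gcd (gcd[m,n]∣n m n)
  where
  r∣gcd : r ∣ gcd m n
  r∣gcd = ≡.subst (r ∣_) (≡.sym gcd≡r*∏rs) (m∣m*n _)

module _ {c ℓ} (R : CommutativeRing c ℓ) where
  open CommutativeRing R
  open import Algebra.Properties.Semiring.Mult semiring using () renaming (_×_ to _·_)
  open import Algebra.Properties.Semiring.Exp semiring using (_^_)
  import Algebra.Properties.CommutativeSemiring.Binomial commutativeSemiring as Binomial
  import Algebra.Properties.Semiring.Sum semiring as SemiringSum
  open import Relation.Binary.Reasoning.Setoid setoid

  binomial-without-inner-terms : ∀ x y n → 0 < n → (∀ k → 0 < k → k < n → (n C k) · (x ^ k * y ^ (n ∸ k)) ≈ 0#) →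
                                 (x + y) ^ n ≈ x ^ n + y ^ n
  binomial-without-inner-terms x y (suc n) _ inner≈0 = begin
    (x + y) ^ suc n
      ≈⟨ Binomial.theorem (suc n) x y ⟩
    SemiringSum.sum term
      ≈⟨ +-congˡ (SemiringSum.sum-init-last (term ∘ Fin.suc)) ⟩
    term Fin.zero + (SemiringSum.sum (init (term ∘ Fin.suc)) + last (term ∘ Fin.suc))
      ≈⟨ +-cong first (+-cong (trans (SemiringSum.sum-cong-≋ inner) (SemiringSum.sum-replicate-zero n)) final) ⟩
    y ^ suc n + (0# + x ^ suc n)
      ≈⟨ trans (+-congˡ (+-identityˡ _)) (+-comm _ _) ⟩
    x ^ suc n + y ^ suc n ∎
    where
    term : Fin (suc (suc n)) → Carrier
    term k = (suc n C toℕ k) · (x ^ toℕ k * y ^ (suc n ∸ toℕ k))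
    first : term Fin.zero ≈ y ^ suc n
    first = trans (+-identityʳ _) (*-identityˡ _)
    inner : ∀ k → term (Fin.suc (inject₁ k)) ≈ 0#
    inner k = inner≈0 (suc (toℕ (inject₁ k))) (s≤s z≤n)
                      (s≤s (≡.subst (ℕ._< n) (≡.sym (Fin.toℕ-inject₁ k)) (Fin.toℕ<n k)))
    final : last (term ∘ Fin.suc) ≈ x ^ suc n
    final = begin
      term (Fin.suc (fromℕ n))
        ≡⟨ ≡.cong (λ m → (suc n C m) · (x ^ m * y ^ (suc n ∸ m))) (≡.cong suc (Fin.toℕ-fromℕ n)) ⟩
      (suc n C suc n) · (x ^ suc n * y ^ (suc n ∸ suc n))
        ≡⟨ ≡.cong₂ (λ a b → a · (x ^ suc n * y ^ b)) (nCn≡1 (suc n)) (ℕ.n∸n≡0 (suc n)) ⟩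
      1 · (x ^ suc n * 1#)
        ≈⟨ trans (+-identityʳ _) (*-identityʳ _) ⟩
      x ^ suc n ∎

module Frobenius {c ℓ} (R : CommutativeRing c ℓ) {p} (p-prime : Prime p) where
  open CommutativeRing R
  open RingProperties R using (1^n≈1)
  open import Algebra.Properties.Semiring.Mult semiring using (×-congʳ; ×-assocˡ; ×-assoc-*) renaming (_×_ to _·_)
  open import Algebra.Properties.Semiring.Exp semiring using (_^_; ^-congˡ; ^-assocʳ)
  open import Algebra.Properties.CommutativeSemiring.Exp commutativeSemiring using (^-distrib-*)
  open import Relation.Binary.Reasoning.Setoid setoid

  module _ (p·1≈0 : p · 1# ≈ 0#) where

    p·x≈0 : ∀ x → p · x ≈ 0#
    p·x≈0 x = begin
      p · x          ≈⟨ ×-congʳ p (*-identityˡ x) ⟨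
      p · (1# * x)   ≈⟨ ×-assoc-* p 1# x ⟨
      (p · 1#) * x   ≈⟨ *-congʳ p·1≈0 ⟩
      0# * x         ≈⟨ zeroˡ x ⟩
      0#             ∎

    binomialTerm-inner≈0 : ∀ x y k → 0 < k → k < p → (p C k) · (x ^ k * y ^ (p ∸ k)) ≈ 0#
    binomialTerm-inner≈0 x y k 0<k k<p with prime∣pCk p-prime 0<k k<p
    ... | divides m pCk≡m*p = begin
      (p C k) · z       ≡⟨ ≡.cong (_· z) (≡.trans pCk≡m*p (ℕ.*-comm m p)) ⟩
      (p ℕ.* m) · z     ≈⟨ ×-assocˡ z p m ⟨
      p · (m · z)       ≈⟨ p·x≈0 (m · z) ⟩
      0#                ∎
      where
      z : Carrier
      z = x ^ k * y ^ (p ∸ k)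

    freshman's-dream : ∀ x y → (x + y) ^ p ≈ x ^ p + y ^ p
    freshman's-dream x y =
      binomial-without-inner-terms R x y p (ℕ.<-trans (s≤s z≤n) (prime⇒2≤ p-prime)) (binomialTerm-inner≈0 x y)

    frobenius-+ : ∀ n x y → (x + y) ^ (p ℕ.^ n) ≈ x ^ (p ℕ.^ n) + y ^ (p ℕ.^ n)
    frobenius-+ zero    x y = trans (*-identityʳ _) (sym (+-cong (*-identityʳ x) (*-identityʳ y)))
    frobenius-+ (suc n) x y = begin
      (x + y) ^ (p ℕ.* p ℕ.^ n)                   ≈⟨ ^-assocʳ (x + y) p (p ℕ.^ n) ⟨
      ((x + y) ^ p) ^ (p ℕ.^ n)                   ≈⟨ ^-congˡ (p ℕ.^ n) (freshman's-dream x y) ⟩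
      (x ^ p + y ^ p) ^ (p ℕ.^ n)                 ≈⟨ frobenius-+ n (x ^ p) (y ^ p) ⟩
      (x ^ p) ^ (p ℕ.^ n) + (y ^ p) ^ (p ℕ.^ n)   ≈⟨ +-cong (^-assocʳ x p (p ℕ.^ n)) (^-assocʳ y p (p ℕ.^ n)) ⟩
      x ^ (p ℕ.* p ℕ.^ n) + y ^ (p ℕ.* p ℕ.^ n)   ∎

    frobenius-isRingHomomorphism : ∀ n → IsRingHomomorphism rawRing rawRing (_^ (p ℕ.^ n))
    frobenius-isRingHomomorphism n =
      mkIsRingHomomorphism {R = R} {S = R} (_^ (p ℕ.^ n)) (^-congˡ (p ℕ.^ n)) (frobenius-+ n)
        (λ x y → ^-distrib-* x y (p ℕ.^ n)) (1^n≈1 (p ℕ.^ n))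

¬injective-missing : ∀ {n} (f : Fin n → Fin n) k → (∀ i → f i ≢ k) → (∀ {i j} → f i ≡ f j → i ≡ j) → ⊥
¬injective-missing {suc n} f k f≢k f-injective = ℕ.<-irrefl ≡.refl (Fin.injective⇒≤ {f = g} g-injective)
  where
  g : Fin (suc n) → Fin n
  g i = punchOut (f≢k i ∘ ≡.sym)
  g-injective : ∀ {i j} → g i ≡ g j → i ≡ j
  g-injective {i} {j} = f-injective ∘ Fin.punchOut-injective (f≢k i ∘ ≡.sym) (f≢k j ∘ ≡.sym)

record FiniteField c ℓ : Set (lsuc (c ⊔ ℓ)) where
  field
    commutativeRing : CommutativeRing c ℓ
    isField        : IsField commutativeRing
    size           : ℕ
    hasCardinality : HasCardinality commutativeRing size
  open CommutativeRing commutativeRing public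

module FiniteFieldProperties {c ℓ} (K : FiniteField c ℓ) where
  open FiniteField K
  open import Relation.Binary.Reasoning.Setoid setoid
  open import Algebra.Properties.Semiring.Exp semiring using (_^_; ^-congˡ; ^-assocʳ)
  open import Algebra.Properties.Semiring.Mult semiring using () renaming (_×_ to _·_)
  open import Algebra.Properties.Group +-group using ()
    renaming (∙-cancelʳ to +-cancelʳ; x∙y⁻¹≈ε⇒x≈y to x-y≈0⇒x≈y; x≈y⇒x∙y⁻¹≈ε to x≈y⇒x-y≈0)
  open import Algebra.Properties.CommutativeSemigroup *-commutativeSemigroup using (x∙yz≈y∙xz)
  open ℤ-Solver commutativeRing
  open RingProperties commutativeRing using (quadratic; quadratic-cong; quadratic≈0⇒s*z≈z*z+n)

  private
    module ∑ = CommutativeMonoidSum +-commutativeMonoid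
    module ∏ = CommutativeMonoidSum *-commutativeMonoid

  enum : Fin size → Carrier
  enum = proj₁ hasCardinality

  enum-injective : ∀ i j → enum i ≈ enum j → i ≡ j
  enum-injective = proj₁ (proj₂ hasCardinality)

  index : Carrier → Fin size
  index x = proj₁ (proj₂ (proj₂ hasCardinality) x)

  enum-index : ∀ x → enum (index x) ≈ x
  enum-index x = proj₂ (proj₂ (proj₂ hasCardinality) x)

  index-cong : ∀ {x y} → x ≈ y → index x ≡ index y
  index-cong {x} {y} x≈y = enum-injective _ _ (trans (enum-index x) (trans x≈y (sym (enum-index y))))

  index-enum : ∀ i → index (enum i) ≡ i
  index-enum i = enum-injective _ _ (enum-index (enum i))

  index-injective : ∀ {x y} → index x ≡ index y → x ≈ y
  index-injective {x} {y} eq = trans (sym (enum-index x)) (trans (reflexive (≡.cong enum eq)) (enum-index y))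

  infix 4 _≟_
  _≟_ : Decidable _≈_
  x ≟ y = Dec.map′ index-injective index-cong (index x Fin.≟ index y)

  ∃? : ∀ {p} {P : Carrier → Set p} → (∀ {x y} → x ≈ y → P x → P y) → (∀ x → Dec (P x)) → Dec (∃ P)
  ∃? resp P? = Dec.map′ (λ (i , Pi) → enum i , Pi) (λ (x , Px) → index x , resp (sym (enum-index x)) Px)
                        (Fin.any? (P? ∘ enum))

  1≉0 : 1# ≉ 0#
  1≉0 = proj₁ isField

  inverse : (x : Carrier) → x ≉ 0# → Carrier
  inverse x x≉0 = proj₁ (proj₂ isField x x≉0)

  x*inverse≈1 : ∀ {x} (x≉0 : x ≉ 0#) → x * inverse x x≉0 ≈ 1#
  x*inverse≈1 {x} x≉0 = proj₂ (proj₂ isField x x≉0)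

  *-cancelˡ : ∀ {x y z} → x ≉ 0# → x * y ≈ x * z → y ≈ z
  *-cancelˡ {x} {y} {z} x≉0 xy≈xz = begin
    y                 ≈⟨ *-identityˡ y ⟨
    1# * y            ≈⟨ *-congʳ x⁻¹x≈1 ⟨
    (x⁻¹ * x) * y     ≈⟨ *-assoc x⁻¹ x y ⟩
    x⁻¹ * (x * y)     ≈⟨ *-congˡ xy≈xz ⟩
    x⁻¹ * (x * z)     ≈⟨ *-assoc x⁻¹ x z ⟨
    (x⁻¹ * x) * z     ≈⟨ *-congʳ x⁻¹x≈1 ⟩
    1# * z            ≈⟨ *-identityˡ z ⟩
    z                 ∎
    where
    x⁻¹ : Carrier
    x⁻¹ = inverse x x≉0
    x⁻¹x≈1 : x⁻¹ * x ≈ 1#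
    x⁻¹x≈1 = trans (*-comm x⁻¹ x) (x*inverse≈1 x≉0)

  *-cancelʳ : ∀ {x y z} → z ≉ 0# → x * z ≈ y * z → x ≈ y
  *-cancelʳ {x} {y} {z} z≉0 xz≈yz = *-cancelˡ z≉0 (trans (*-comm z x) (trans xz≈yz (*-comm y z)))

  zero-product : ∀ {x y} → x * y ≈ 0# → x ≈ 0# ⊎ y ≈ 0#
  zero-product {x} {y} xy≈0 with x ≟ 0#
  ... | yes x≈0 = inj₁ x≈0
  ... | no  x≉0 = inj₂ (*-cancelˡ x≉0 (trans xy≈0 (sym (zeroʳ x))))

  *-nonzero : ∀ {x y} → x ≉ 0# → y ≉ 0# → x * y ≉ 0#
  *-nonzero x≉0 y≉0 = [ x≉0 , y≉0 ]′ ∘ zero-product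

  x*x≈0⇒x≈0 : ∀ {x} → x * x ≈ 0# → x ≈ 0#
  x*x≈0⇒x≈0 = [ (λ x≈0 → x≈0) , (λ x≈0 → x≈0) ]′ ∘ zero-product

  ∏-nonzero : ∀ {n} {f : Fin n → Carrier} → (∀ i → f i ≉ 0#) → ∏.sum f ≉ 0#
  ∏-nonzero {zero}  f≉0 = 1≉0
  ∏-nonzero {suc n} f≉0 = *-nonzero (f≉0 Fin.zero) (∏-nonzero (f≉0 ∘ Fin.suc))

  x^n≈0⇒x≈0 : ∀ {x} n → x ^ n ≈ 0# → x ≈ 0#
  x^n≈0⇒x≈0 zero    1≈0  = ⊥-elim (1≉0 1≈0)
  x^n≈0⇒x≈0 (suc n) xxⁿ≈0 = [ (λ x≈0 → x≈0) , x^n≈0⇒x≈0 n ]′ (zero-product xxⁿ≈0)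

  carrierPermutation : (f g : Carrier → Carrier) → (∀ {x y} → x ≈ y → f x ≈ f y) → (∀ {x y} → x ≈ y → g x ≈ g y) →
                       (∀ x → f (g x) ≈ x) → (∀ x → g (f x) ≈ x) → Permutation size size
  carrierPermutation f g f-cong g-cong fg≈id gf≈id =
    permutation (index ∘ f ∘ enum) (index ∘ g ∘ enum)
                (inverse-on-indices f g f-cong fg≈id) (inverse-on-indices g f g-cong gf≈id)
    where
    inverse-on-indices : ∀ f g → (∀ {x y} → x ≈ y → f x ≈ f y) → (∀ x → f (g x) ≈ x) →
                         ∀ i → index (f (enum (index (g (enum i))))) ≡ i
    inverse-on-indices f g f-cong fg≈id i =
      ≡.trans (index-cong (trans (f-cong (enum-index (g (enum i)))) (fg≈id (enum i)))) (index-enum i)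

  -- Translation by 1 permutes the field, so it does not change the sum of all elements.
  size·1≈0 : size · 1# ≈ 0#
  size·1≈0 = +-cancelʳ (∑.sum enum) (size · 1#) 0# (begin
    size · 1# + ∑.sum enum               ≈⟨ +-congʳ (∑.sum-replicate size) ⟨
    ∑.sum {size} (λ _ → 1#) + ∑.sum enum ≈⟨ ∑.∑-distrib-+ (λ _ → 1#) enum ⟨
    ∑.sum (λ i → 1# + enum i)            ≈⟨ ∑.sum-cong-≋ (λ i → sym (enum-index (1# + enum i))) ⟩
    ∑.sum (λ i → enum (π ⟨$⟩ʳ i))        ≈⟨ ∑.sum-permute enum π ⟨
    ∑.sum enum                           ≈⟨ +-identityˡ _ ⟨
    0# + ∑.sum enum                      ∎)
    where
    π : Permutation size size
    π = carrierPermutation (1# +_) (- 1# +_) +-congˡ +-congˡ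
          (λ x → trans (sym (+-assoc _ _ _)) (trans (+-congʳ (-‿inverseʳ 1#)) (+-identityˡ x)))
          (λ x → trans (sym (+-assoc _ _ _)) (trans (+-congʳ (-‿inverseˡ 1#)) (+-identityˡ x)))

  2≤size : 2 ≤ size
  2≤size = Fin.injective⇒≤ {f = zero-or-one} zero-or-one-injective
    where
    zero-or-one : Fin 2 → Fin size
    zero-or-one Fin.zero    = index 0#
    zero-or-one (Fin.suc _) = index 1#
    zero-or-one-injective : ∀ {i j} → zero-or-one i ≡ zero-or-one j → i ≡ j
    zero-or-one-injective {Fin.zero}         {Fin.zero}         _  = ≡.refl
    zero-or-one-injective {Fin.suc Fin.zero} {Fin.suc Fin.zero} _  = ≡.refl
    zero-or-one-injective {Fin.zero}         {Fin.suc _}        eq = ⊥-elim (1≉0 (sym (index-injective eq)))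
    zero-or-one-injective {Fin.suc _}        {Fin.zero}         eq = ⊥-elim (1≉0 (index-injective eq))

  ∏-scaleAt : ∀ {n} (f g : Fin n → Carrier) i a → (∀ j → j ≢ i → f j ≈ g j) → f i ≈ a * g i → ∏.sum f ≈ a * ∏.sum g
  ∏-scaleAt f g Fin.zero a f≈g fi≈agi = begin
    f Fin.zero * ∏.sum (f ∘ Fin.suc)       ≈⟨ *-cong fi≈agi (∏.sum-cong-≋ (λ j → f≈g (Fin.suc j) λ ())) ⟩
    a * g Fin.zero * ∏.sum (g ∘ Fin.suc)   ≈⟨ *-assoc _ _ _ ⟩
    a * ∏.sum g                            ∎
  ∏-scaleAt f g (Fin.suc i) a f≈g fi≈agi = begin
    f Fin.zero * ∏.sum (f ∘ Fin.suc)       ≈⟨ *-cong (f≈g Fin.zero λ ())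
                                                     (∏-scaleAt (f ∘ Fin.suc) (g ∘ Fin.suc) i a
                                                        (λ j j≢i → f≈g (Fin.suc j) (j≢i ∘ Fin.suc-injective)) fi≈agi) ⟩
    g Fin.zero * (a * ∏.sum (g ∘ Fin.suc)) ≈⟨ x∙yz≈y∙xz _ _ _ ⟩
    a * ∏.sum g                            ∎

  private
    nonzeroPart : Carrier → Carrier
    nonzeroPart x with x ≟ 0#
    ... | yes _ = 1#
    ... | no  _ = x

    nonzeroPart-cong : ∀ {x y} → x ≈ y → nonzeroPart x ≈ nonzeroPart y
    nonzeroPart-cong {x} {y} x≈y with x ≟ 0# | y ≟ 0#
    ... | yes _   | yes _   = refl
    ... | yes x≈0 | no  y≉0 = ⊥-elim (y≉0 (trans (sym x≈y) x≈0))
    ... | no  x≉0 | yes y≈0 = ⊥-elim (x≉0 (trans x≈y y≈0))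
    ... | no  _   | no  _   = x≈y

    nonzeroPart≉0 : ∀ x → nonzeroPart x ≉ 0#
    nonzeroPart≉0 x with x ≟ 0#
    ... | yes _   = 1≉0
    ... | no  x≉0 = x≉0

    nonzeroPart-of-≉0 : ∀ {x} → x ≉ 0# → nonzeroPart x ≈ x
    nonzeroPart-of-≉0 {x} x≉0 with x ≟ 0#
    ... | yes x≈0 = ⊥-elim (x≉0 x≈0)
    ... | no  _   = refl

    nonzeroPart-of-≈0 : ∀ {x} → x ≈ 0# → nonzeroPart x ≈ 1#
    nonzeroPart-of-≈0 {x} x≈0 with x ≟ 0#
    ... | yes _   = refl
    ... | no  x≉0 = ⊥-elim (x≉0 x≈0)

  -- Multiplication by x ≉ 0 permutes the field; comparing the products of all elements, with 0
  -- replaced by 1, before and after gives x ^ size * P ≈ x * P with P ≉ 0.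
  x^size≈x : ∀ x → x ^ size ≈ x
  x^size≈x x with x ≟ 0#
  ... | yes x≈0 = ^-of-zero size (ℕ.≤-trans (s≤s z≤n) 2≤size)
    where
    ^-of-zero : ∀ n → 1 ≤ n → x ^ n ≈ x
    ^-of-zero (suc n) _ = trans (*-congʳ x≈0) (trans (zeroˡ _) (sym x≈0))
  ... | no  x≉0 = *-cancelʳ (∏-nonzero (λ i → nonzeroPart≉0 (enum i))) (begin
    x ^ size * ∏.sum h                  ≈⟨ *-congʳ (∏.sum-replicate size) ⟨
    ∏.sum {size} (λ _ → x) * ∏.sum h    ≈⟨ ∏.∑-distrib-+ (λ _ → x) h ⟨
    ∏.sum (λ i → x * h i)               ≈⟨ ∏-scaleAt _ _ (index 0#) x scaled-elsewhere (*-congˡ scaled-at-0) ⟩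
    x * ∏.sum (λ i → h (π ⟨$⟩ʳ i))      ≈⟨ *-congˡ (∏.sum-permute h π) ⟨
    x * ∏.sum h                         ∎)
    where
    h : Fin size → Carrier
    h = nonzeroPart ∘ enum
    π : Permutation size size
    π = carrierPermutation (x *_) (inverse x x≉0 *_) *-congˡ *-congˡ
          (λ y → trans (sym (*-assoc _ _ _)) (trans (*-congʳ (x*inverse≈1 x≉0)) (*-identityˡ y)))
          (λ y → trans (sym (*-assoc _ _ _)) (trans (*-congʳ (trans (*-comm _ _) (x*inverse≈1 x≉0))) (*-identityˡ y)))
    h∘π : ∀ i → h (π ⟨$⟩ʳ i) ≈ nonzeroPart (x * enum i)
    h∘π i = nonzeroPart-cong (enum-index _)
    scaled-elsewhere : ∀ i → i ≢ index 0# → x * h i ≈ h (π ⟨$⟩ʳ i)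
    scaled-elsewhere i i≢i₀ = begin
      x * nonzeroPart (enum i)    ≈⟨ *-congˡ (nonzeroPart-of-≉0 enum-i≉0) ⟩
      x * enum i                  ≈⟨ nonzeroPart-of-≉0 (*-nonzero x≉0 enum-i≉0) ⟨
      nonzeroPart (x * enum i)    ≈⟨ h∘π i ⟨
      h (π ⟨$⟩ʳ i)                ∎
      where
      enum-i≉0 : enum i ≉ 0#
      enum-i≉0 enum-i≈0 = i≢i₀ (≡.trans (≡.sym (index-enum i)) (index-cong enum-i≈0))
    scaled-at-0 : h (index 0#) ≈ h (π ⟨$⟩ʳ index 0#)
    scaled-at-0 = begin
      nonzeroPart (enum (index 0#))      ≈⟨ nonzeroPart-of-≈0 (enum-index 0#) ⟩
      1#                                 ≈⟨ nonzeroPart-of-≈0 (trans (*-congˡ (enum-index 0#)) (zeroʳ x)) ⟨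
      nonzeroPart (x * enum (index 0#))  ≈⟨ h∘π (index 0#) ⟨
      h (π ⟨$⟩ʳ index 0#)                ∎

  -- A list c₀ ∷ … ∷ c_{d-1} stands for the monic polynomial c₀ + c₁ X + ⋯ + c_{d-1} X^{d-1} + X^d,
  -- and quotient p r for the quotient of p by X - r.
  evalMonic : List Carrier → Carrier → Carrier
  evalMonic []       x = 1#
  evalMonic (c ∷ cs) x = c + x * evalMonic cs x

  quotient : List Carrier → Carrier → List Carrier
  quotient []            r = []
  quotient (c₀ ∷ [])      r = []
  quotient (c₀ ∷ c₁ ∷ cs) r = evalMonic (c₁ ∷ cs) r ∷ quotient (c₁ ∷ cs) r

  length-quotient : ∀ c cs r → List.length (quotient (c ∷ cs) r) ≡ List.length cs
  length-quotient c []        r = ≡.refl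
  length-quotient c (c₁ ∷ cs) r = ≡.cong suc (length-quotient c₁ cs r)

  division : ∀ c cs r x →
             evalMonic (c ∷ cs) x ≈ (x - r) * evalMonic (quotient (c ∷ cs) r) x + evalMonic (c ∷ cs) r
  division c₀ [] r x =
    solve 3 (λ c₀ x r → c₀ :+ x :* :one := (x :- r) :* :one :+ (c₀ :+ r :* :one)) refl c₀ x r
  division c₀ (c₁ ∷ cs) r x = begin
    c₀ + x * evalMonic (c₁ ∷ cs) x
      ≈⟨ +-congˡ (*-congˡ (division c₁ cs r x)) ⟩
    c₀ + x * ((x - r) * evalMonic (quotient (c₁ ∷ cs) r) x + evalMonic (c₁ ∷ cs) r)
      ≈⟨ solve 5 (λ c₀ x r Q P → c₀ :+ x :* ((x :- r) :* Q :+ P) := (x :- r) :* (P :+ x :* Q) :+ (c₀ :+ r :* P))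
               refl c₀ x r (evalMonic (quotient (c₁ ∷ cs) r) x) (evalMonic (c₁ ∷ cs) r) ⟩
    (x - r) * (evalMonic (c₁ ∷ cs) r + x * evalMonic (quotient (c₁ ∷ cs) r) x) + (c₀ + r * evalMonic (c₁ ∷ cs) r)
      ∎

  root-bound : ∀ {m} cs (r : Fin m → Carrier) → (∀ i j → r i ≈ r j → i ≡ j) →
               (∀ i → evalMonic cs (r i) ≈ 0#) → m ≤ List.length cs
  root-bound {zero}  cs        r r-injective roots = z≤n
  root-bound {suc m} []        r r-injective roots = ⊥-elim (1≉0 (roots Fin.zero))
  root-bound {suc m} (c ∷ cs)  r r-injective roots =
    s≤s (≡.subst (m ≤_) (length-quotient c cs r₀)
      (root-bound (quotient (c ∷ cs) r₀) (r ∘ Fin.suc) (λ i j → Fin.suc-injective ∘ r-injective _ _) quotient-roots))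
    where
    r₀ : Carrier
    r₀ = r Fin.zero
    quotient-roots : ∀ i → evalMonic (quotient (c ∷ cs) r₀) (r (Fin.suc i)) ≈ 0#
    quotient-roots i with zero-product (begin
      (rᵢ - r₀) * evalMonic (quotient (c ∷ cs) r₀) rᵢ         ≈⟨ +-identityʳ _ ⟨
      (rᵢ - r₀) * evalMonic (quotient (c ∷ cs) r₀) rᵢ + 0#    ≈⟨ +-congˡ (roots Fin.zero) ⟨
      _                                                       ≈⟨ division c cs r₀ rᵢ ⟨
      evalMonic (c ∷ cs) rᵢ                                   ≈⟨ roots (Fin.suc i) ⟩
      0#                                                      ∎)
      where
      rᵢ : Carrier
      rᵢ = r (Fin.suc i)
    ... | inj₂ q≈0  = q≈0
    ... | inj₁ r≈r₀ with r-injective _ _ (x-y≈0⇒x≈y _ _ r≈r₀)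
    ...   | ()

  X^[2+k]-X : ℕ → List Carrier
  X^[2+k]-X k = 0# ∷ - 1# ∷ List.replicate k 0#

  evalMonic-X^[2+k]-X : ∀ k x → evalMonic (X^[2+k]-X k) x ≈ x ^ (2 ℕ.+ k) - x
  evalMonic-X^[2+k]-X k x = begin
    0# + x * (- 1# + x * evalMonic (List.replicate k 0#) x)
      ≈⟨ +-congˡ (*-congˡ (+-congˡ (*-congˡ (evalMonic-Xᵏ k)))) ⟩
    0# + x * (- 1# + x * x ^ k)
      ≈⟨ solve 2 (λ x X → :zero :+ x :* (:- :one :+ x :* X) := x :* (x :* X) :- x) refl x (x ^ k) ⟩
    x * (x * x ^ k) - x ∎
    where
    evalMonic-Xᵏ : ∀ k → evalMonic (List.replicate k 0#) x ≈ x ^ k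
    evalMonic-Xᵏ zero    = refl
    evalMonic-Xᵏ (suc k) = trans (+-identityˡ _) (*-congˡ (evalMonic-Xᵏ k))

  fixed-points-of-power-bound : ∀ {m e} → 2 ≤ e → (r : Fin m → Carrier) → (∀ i j → r i ≈ r j → i ≡ j) →
                                (∀ i → r i ^ e ≈ r i) → m ≤ e
  fixed-points-of-power-bound {e = suc (suc k)} (s≤s (s≤s _)) r r-injective fixed =
    ≡.subst (λ d → _ ≤ 2 ℕ.+ d) (List.length-replicate k)
      (root-bound (X^[2+k]-X k) r r-injective (λ i → trans (evalMonic-X^[2+k]-X k (r i)) (x≈y⇒x-y≈0 (fixed i))))

  ∃-nontrivial-root-of-unity : ∀ {r d} → 2 ≤ r → size ≡ suc (d ℕ.* r) → ∃ λ t → t ^ r ≈ 1# × t ≉ 1#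
  ∃-nontrivial-root-of-unity {r} {d} 2≤r size≡1+dr
    with ∃? (λ x≈y x^[1+d]≉x y^[1+d]≈y → x^[1+d]≉x (trans (^-congˡ (suc d) x≈y) (trans y^[1+d]≈y (sym x≈y))))
            (λ x → Dec.¬? (x ^ suc d ≟ x))
  ... | yes (x , x^[1+d]≉x) = x ^ d , x^dr≈1 , x^d≉1
    where
    x≉0 : x ≉ 0#
    x≉0 x≈0 = x^[1+d]≉x (trans (*-congʳ x≈0) (trans (zeroˡ _) (sym x≈0)))
    x^dr≈1 : (x ^ d) ^ r ≈ 1#
    x^dr≈1 = trans (^-assocʳ x d r) (*-cancelˡ x≉0 (begin
      x * x ^ (d ℕ.* r)   ≡⟨ ≡.cong (x ^_) size≡1+dr ⟨
      x ^ size            ≈⟨ x^size≈x x ⟩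
      x                   ≈⟨ *-identityʳ x ⟨
      x * 1#              ∎))
    x^d≉1 : x ^ d ≉ 1#
    x^d≉1 x^d≈1 = x^[1+d]≉x (trans (*-congˡ x^d≈1) (*-identityʳ x))
  ... | no all-fixed = ⊥-elim (ℕ.<⇒≱ size>1+d (fixed-points-of-power-bound 2≤1+d enum enum-injective (fixed ∘ enum)))
    where
    fixed : ∀ x → x ^ suc d ≈ x
    fixed x = Dec.decidable-stable (x ^ suc d ≟ x) (λ x^[1+d]≉x → all-fixed (x , x^[1+d]≉x))
    positive : ∀ d → size ≡ suc (d ℕ.* r) → 1 ≤ d
    positive zero    size≡1 = ⊥-elim (ℕ.<-irrefl (≡.sym size≡1) 2≤size)
    positive (suc _) _      = s≤s z≤n
    1≤d : 1 ≤ d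
    1≤d = positive d size≡1+dr
    2≤1+d : 2 ≤ suc d
    2≤1+d = s≤s 1≤d
    size>1+d : suc d < size
    size>1+d = ≡.subst (suc d <_) (≡.sym size≡1+dr) (s≤s (ℕ.m<m*n d r {{ℕ.>-nonZero 1≤d}} 2≤r))

  x*y≈1⇒x≉0 : ∀ {x y} → x * y ≈ 1# → x ≉ 0#
  x*y≈1⇒x≉0 xy≈1 x≈0 = 1≉0 (trans (sym xy≈1) (trans (*-congʳ x≈0) (zeroˡ _)))

  inverse-unique : ∀ {x y z} → x * y ≈ 1# → x * z ≈ 1# → y ≈ z
  inverse-unique xy≈1 xz≈1 = *-cancelˡ (x*y≈1⇒x≉0 xy≈1) (trans xy≈1 (sym xz≈1))

  sum-and-product⇒≈ : ∀ {a b c} → a + b ≈ c + c → a * b ≈ c * c → a ≈ c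
  sum-and-product⇒≈ {a} {b} {c} a+b≈2c ab≈c² = x-y≈0⇒x≈y a c (x*x≈0⇒x≈0 (begin
    (a - c) * (a - c)
      ≈⟨ solve 3 (λ a b c → (a :- c) :* (a :- c) := a :* (a :+ b :- (c :+ c)) :- (a :* b :- c :* c)) refl a b c ⟩
    a * (a + b - (c + c)) - (a * b - c * c)
      ≈⟨ +-cong (*-congˡ (x≈y⇒x-y≈0 a+b≈2c)) (-‿cong (x≈y⇒x-y≈0 ab≈c²)) ⟩
    a * 0# - 0#
      ≈⟨ solve 1 (λ a → a :* :zero :- :zero := :zero) refl a ⟩
    0# ∎))

  quadratic-root? : ∀ s n → Dec (∃ λ z → quadratic s n z ≈ 0#)
  quadratic-root? s n = ∃? (λ z≈w → trans (quadratic-cong refl refl (sym z≈w))) (λ z → quadratic s n z ≟ 0#)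

  -- If every z² - a z + 1 had a root z_a, then a ↦ z_a would be an injective map from the field
  -- to its nonzero elements, since a z_a ≈ z_a z_a + 1.
  ∃-irreducible-z²-az+1 : ∃ λ a → ¬ ∃ λ z → quadratic a 1# z ≈ 0#
  ∃-irreducible-z²-az+1 with ∃? (λ a≈b noRoot (z , root) → noRoot (z , trans (quadratic-cong a≈b refl refl) root))
                                (λ a → Dec.¬? (quadratic-root? a 1#))
  ... | yes irreducible = irreducible
  ... | no  reducible = ⊥-elim (¬injective-missing G (index 0#) G≢index0 G-injective)
    where
    root : ∀ a → ∃ λ z → quadratic a 1# z ≈ 0#
    root a = Dec.decidable-stable (quadratic-root? a 1#) (λ noRoot → reducible (a , noRoot))
    G : Fin size → Fin size
    G i = index (proj₁ (root (enum i)))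
    root≉0 : ∀ a → proj₁ (root a) ≉ 0#
    root≉0 a z≈0 = 1≉0 (begin
      1#              ≈⟨ +-identityˡ 1# ⟨
      0# + 1#         ≈⟨ +-congʳ (trans (*-congʳ z≈0) (zeroˡ _)) ⟨
      z * z + 1#      ≈⟨ quadratic≈0⇒s*z≈z*z+n (proj₂ (root a)) ⟨
      a * z           ≈⟨ trans (*-congˡ z≈0) (zeroʳ a) ⟩
      0#              ∎)
      where
      z : Carrier
      z = proj₁ (root a)
    G≢index0 : ∀ i → G i ≢ index 0#
    G≢index0 i eq = root≉0 (enum i) (index-injective eq)
    G-injective : ∀ {i j} → G i ≡ G j → i ≡ j
    G-injective {i} {j} eq = enum-injective i j (*-cancelʳ (root≉0 (enum i)) (begin
      enum i * z       ≈⟨ quadratic≈0⇒s*z≈z*z+n (proj₂ (root (enum i))) ⟩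
      z * z + 1#       ≈⟨ +-congʳ (*-cong z≈z′ z≈z′) ⟩
      z′ * z′ + 1#     ≈⟨ quadratic≈0⇒s*z≈z*z+n (proj₂ (root (enum j))) ⟨
      enum j * z′      ≈⟨ *-congˡ z≈z′ ⟨
      enum j * z       ∎))
      where
      z z′ : Carrier
      z = proj₁ (root (enum i))
      z′ = proj₁ (root (enum j))
      z≈z′ : z ≈ z′
      z≈z′ = index-injective eq

record Extension {c ℓ} (K : FiniteField c ℓ) : Set (lsuc (c ⊔ ℓ)) where
  field
    L : FiniteField c ℓ
    ι : FiniteField.Carrier K → FiniteField.Carrier L
    ι-mono : IsRingMonomorphism (FiniteField.rawRing K) (FiniteField.rawRing L) ι

  ι-homo : IsRingHomomorphism (FiniteField.rawRing K) (FiniteField.rawRing L) ι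
  ι-homo = IsRingMonomorphism.isRingHomomorphism ι-mono

  ι-injective : ∀ {a b} → FiniteField._≈_ L (ι a) (ι b) → FiniteField._≈_ K a b
  ι-injective = IsRingMonomorphism.injective ι-mono

trivialExtension : ∀ {c ℓ} (K : FiniteField c ℓ) → Extension K
trivialExtension K = record
  { L = K ; ι = id ; ι-mono = Identity.isRingMonomorphism (FiniteField.rawRing K) (FiniteField.refl K) }

extend : ∀ {c ℓ} {K : FiniteField c ℓ} (E : Extension K) → Extension (Extension.L E) → Extension K
extend E E′ = record
  { L = E′.L ; ι = E′.ι ∘ E.ι ; ι-mono = Composition.isRingMonomorphism (FiniteField.trans E′.L) E.ι-mono E′.ι-mono }
  where
  module E = Extension E
  module E′ = Extension E′

record ExtensionWithRoot {c ℓ} (K : FiniteField c ℓ) (s n : FiniteField.Carrier K) : Set (lsuc (c ⊔ ℓ)) where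
  field
    extension : Extension K
  open Extension extension public
  open FiniteField L using (_≈_; 0#)
  field
    root : FiniteField.Carrier L
    isRoot : RingProperties.quadratic (FiniteField.commutativeRing L) (ι s) (ι n) root ≈ 0#

module QuadraticExtension {c ℓ} (K : FiniteField c ℓ) (s n : FiniteField.Carrier K)
  (irreducible : ¬ ∃ λ z → FiniteField._≈_ K (RingProperties.quadratic (FiniteField.commutativeRing K) s n z)
                                              (FiniteField.0# K))
  where
  open FiniteField K
  open FiniteFieldProperties K
  open ℤ-Solver commutativeRing
  open RingProperties commutativeRing using (quadratic)
  open import Relation.Binary.Reasoning.Setoid setoid

  -- (a , b) stands for a + b w, where w² = s w - n.
  private
    Pair : Set c
    Pair = Carrier × Carrier

    _≈ₚ_ : Pair → Pair → Set ℓ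
    _≈ₚ_ = Pointwise _≈_ _≈_

    _+ₚ_ : Pair → Pair → Pair
    (a , b) +ₚ (c , d) = a + c , b + d

    -ₚ_ : Pair → Pair
    -ₚ (a , b) = - a , - b

    _*ₚ_ : Pair → Pair → Pair
    (a , b) *ₚ (c , d) = a * c - n * (b * d) , a * d + b * c + s * (b * d)

    :mulₚ : ∀ {m} (s n : Polynomial m) →
            Polynomial m × Polynomial m → Polynomial m × Polynomial m → Polynomial m × Polynomial m
    :mulₚ s n (a , b) (c , d) = a :* c :- n :* (b :* d) , a :* d :+ b :* c :+ s :* (b :* d)

    isCommutativeRingₚ : IsCommutativeRing _≈ₚ_ _+ₚ_ _*ₚ_ -ₚ_ (0# , 0#) (1# , 0#)
    isCommutativeRingₚ = record
      { isRing = record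
        { +-isAbelianGroup = AbelianGroup.isAbelianGroup (DirectProduct.abelianGroup +-abelianGroup +-abelianGroup)
        ; *-cong = λ (a≈ , b≈) (c≈ , d≈) →
            +-cong (*-cong a≈ c≈) (-‿cong (*-congˡ (*-cong b≈ d≈))) ,
            +-cong (+-cong (*-cong a≈ d≈) (*-cong b≈ c≈)) (*-congˡ (*-cong b≈ d≈))
        ; *-assoc = λ (a , b) (c , d) (e , f) →
            solve 8 (λ a b c d e f s n → proj₁ (:mulₚ s n (:mulₚ s n (a , b) (c , d)) (e , f))
                                         := proj₁ (:mulₚ s n (a , b) (:mulₚ s n (c , d) (e , f)))) refl a b c d e f s n ,
            solve 8 (λ a b c d e f s n → proj₂ (:mulₚ s n (:mulₚ s n (a , b) (c , d)) (e , f))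
                                         := proj₂ (:mulₚ s n (a , b) (:mulₚ s n (c , d) (e , f)))) refl a b c d e f s n
        ; *-identity =
            (λ (a , b) → solve 4 (λ a b s n → proj₁ (:mulₚ s n (:one , :zero) (a , b)) := a) refl a b s n ,
                         solve 4 (λ a b s n → proj₂ (:mulₚ s n (:one , :zero) (a , b)) := b) refl a b s n) ,
            (λ (a , b) → solve 4 (λ a b s n → proj₁ (:mulₚ s n (a , b) (:one , :zero)) := a) refl a b s n ,
                         solve 4 (λ a b s n → proj₂ (:mulₚ s n (a , b) (:one , :zero)) := b) refl a b s n)
        ; distrib =
            (λ (a , b) (c , d) (e , f) →
              solve 8 (λ a b c d e f s n → proj₁ (:mulₚ s n (a , b) (c :+ e , d :+ f))
                                           := proj₁ (:mulₚ s n (a , b) (c , d)) :+ proj₁ (:mulₚ s n (a , b) (e , f)))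
                      refl a b c d e f s n ,
              solve 8 (λ a b c d e f s n → proj₂ (:mulₚ s n (a , b) (c :+ e , d :+ f))
                                           := proj₂ (:mulₚ s n (a , b) (c , d)) :+ proj₂ (:mulₚ s n (a , b) (e , f)))
                      refl a b c d e f s n) ,
            (λ (a , b) (c , d) (e , f) →
              solve 8 (λ a b c d e f s n → proj₁ (:mulₚ s n (c :+ e , d :+ f) (a , b))
                                           := proj₁ (:mulₚ s n (c , d) (a , b)) :+ proj₁ (:mulₚ s n (e , f) (a , b)))
                      refl a b c d e f s n ,
              solve 8 (λ a b c d e f s n → proj₂ (:mulₚ s n (c :+ e , d :+ f) (a , b))
                                           := proj₂ (:mulₚ s n (c , d) (a , b)) :+ proj₂ (:mulₚ s n (e , f) (a , b)))
                      refl a b c d e f s n)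
        }
      ; *-comm = λ (a , b) (c , d) →
          solve 6 (λ a b c d s n → proj₁ (:mulₚ s n (a , b) (c , d)) := proj₁ (:mulₚ s n (c , d) (a , b))) refl a b c d s n ,
          solve 6 (λ a b c d s n → proj₂ (:mulₚ s n (a , b) (c , d)) := proj₂ (:mulₚ s n (c , d) (a , b))) refl a b c d s n
      }

    ringₚ : CommutativeRing c ℓ
    ringₚ = record { isCommutativeRing = isCommutativeRingₚ }

    norm : Carrier → Carrier → Carrier
    norm a b = a * a + s * (a * b) + n * (b * b)

    -- For b ≉ 0, norm a b ≈ b² · quadratic s n (- a / b), which irreducibility keeps nonzero.
    norm-nonzero : ∀ a b → ¬ (a , b) ≈ₚ (0# , 0#) → norm a b ≉ 0#
    norm-nonzero a b ab≉0 norm≈0 with b ≟ 0#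
    ... | yes b≈0 = ab≉0 (x*x≈0⇒x≈0 (begin
      a * a
        ≈⟨ solve 3 (λ a s n → a :* a := a :* a :+ s :* (a :* :zero) :+ n :* (:zero :* :zero)) refl a s n ⟩
      a * a + s * (a * 0#) + n * (0# * 0#)
        ≈⟨ +-cong (+-congˡ (*-congˡ (*-congˡ b≈0))) (*-congˡ (*-cong b≈0 b≈0)) ⟨
      norm a b                           ≈⟨ norm≈0 ⟩
      0#                                 ∎) , b≈0)
    ... | no  b≉0 = irreducible (z , [ id , (λ bb≈0 → ⊥-elim (*-nonzero b≉0 b≉0 bb≈0)) ]′ (zero-product (begin
      quadratic s n z * (b * b)
        ≈⟨ solve 4 (λ z b s n → (z :* z :- s :* z :+ n) :* (b :* b)
                                := (z :* b) :* (z :* b) :- s :* ((z :* b) :* b) :+ n :* (b :* b)) refl z b s n ⟩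
      (z * b) * (z * b) - s * ((z * b) * b) + n * (b * b)
        ≈⟨ +-congʳ (+-cong (*-cong zb≈-a zb≈-a) (-‿cong (*-congˡ (*-congʳ zb≈-a)))) ⟩
      (- a) * (- a) - s * ((- a) * b) + n * (b * b)
        ≈⟨ solve 4 (λ a b s n → (:- a) :* (:- a) :- s :* ((:- a) :* b) :+ n :* (b :* b)
                                := a :* a :+ s :* (a :* b) :+ n :* (b :* b)) refl a b s n ⟩
      norm a b
        ≈⟨ norm≈0 ⟩
      0# ∎)))
      where
      z : Carrier
      z = - a * inverse b b≉0
      zb≈-a : z * b ≈ - a
      zb≈-a = trans (*-assoc _ _ _) (trans (*-congˡ (trans (*-comm _ _) (x*inverse≈1 b≉0))) (*-identityʳ _))

    isFieldₚ : IsField ringₚ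
    isFieldₚ = (λ (1≈0 , _) → 1≉0 1≈0) , inverseₚ
      where
      inverseₚ : ∀ x → ¬ x ≈ₚ (0# , 0#) → ∃ λ y → (x *ₚ y) ≈ₚ (1# , 0#)
      inverseₚ (a , b) ab≉0 =
        ((a + s * b) * N⁻¹ , - b * N⁻¹) ,
        trans (solve 5 (λ a b s n N⁻¹ → proj₁ (:mulₚ s n (a , b) ((a :+ s :* b) :* N⁻¹ , :- b :* N⁻¹))
                                         := (a :* a :+ s :* (a :* b) :+ n :* (b :* b)) :* N⁻¹) refl a b s n N⁻¹)
              (x*inverse≈1 (norm-nonzero a b ab≉0)) ,
        solve 5 (λ a b s n N⁻¹ → proj₂ (:mulₚ s n (a , b) ((a :+ s :* b) :* N⁻¹ , :- b :* N⁻¹)) := :zero) refl a b s n N⁻¹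
        where
        N⁻¹ : Carrier
        N⁻¹ = inverse (norm a b) (norm-nonzero a b ab≉0)

    hasCardinalityₚ : HasCardinality ringₚ (size ℕ.* size)
    hasCardinalityₚ = enumₚ , enumₚ-injective , λ (a , b) → combine (index a) (index b) , enumₚ-combine a b
      where
      enumₚ : Fin (size ℕ.* size) → Pair
      enumₚ k = enum (proj₁ (remQuot {size} size k)) , enum (proj₂ (remQuot {size} size k))
      enumₚ-injective : ∀ i j → enumₚ i ≈ₚ enumₚ j → i ≡ j
      enumₚ-injective i j (≈₁ , ≈₂) =
        ≡.trans (≡.sym (Fin.combine-remQuot {size} size i))
                (≡.trans (≡.cong₂ combine (enum-injective _ _ ≈₁) (enum-injective _ _ ≈₂))
                         (Fin.combine-remQuot {size} size j))
      enumₚ-combine : ∀ a b → enumₚ (combine (index a) (index b)) ≈ₚ (a , b)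
      enumₚ-combine a b = trans (reflexive (≡.cong (enum ∘ proj₁) remQuot≡)) (enum-index a) ,
                          trans (reflexive (≡.cong (enum ∘ proj₂) remQuot≡)) (enum-index b)
        where
        remQuot≡ : remQuot {size} size (combine (index a) (index b)) ≡ (index a , index b)
        remQuot≡ = Fin.remQuot-combine {size} {size} (index a) (index b)

  L : FiniteField c ℓ
  L = record { commutativeRing = ringₚ ; isField = isFieldₚ ; size = size ℕ.* size ; hasCardinality = hasCardinalityₚ }

  ι : Carrier → Pair
  ι a = a , 0#

  ι-mono : IsRingMonomorphism rawRing (FiniteField.rawRing L) ι
  ι-mono = record
    { isRingHomomorphism = mkIsRingHomomorphism {R = commutativeRing} {S = ringₚ} ι (λ a≈b → a≈b , refl)
        (λ a b → refl , sym (+-identityʳ 0#))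
        (λ a b → sym (solve 4 (λ a b s n → proj₁ (:mulₚ s n (a , :zero) (b , :zero)) := a :* b) refl a b s n) ,
                 sym (solve 4 (λ a b s n → proj₂ (:mulₚ s n (a , :zero) (b , :zero)) := :zero) refl a b s n))
        (refl , refl)
    ; injective = proj₁ }

  w : Pair
  w = 0# , 1#

  w-root : FiniteField._≈_ L (RingProperties.quadratic ringₚ (ι s) (ι n) w) (0# , 0#)
  w-root =
    solve 2 (λ s n → proj₁ (:mulₚ s n (:zero , :one) (:zero , :one)) :- proj₁ (:mulₚ s n (s , :zero) (:zero , :one)) :+ n
                     := :zero) refl s n ,
    solve 2 (λ s n → proj₂ (:mulₚ s n (:zero , :one) (:zero , :one)) :- proj₂ (:mulₚ s n (s , :zero) (:zero , :one)) :+ :zero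
                     := :zero) refl s n

  extensionWithRoot : ExtensionWithRoot K s n
  extensionWithRoot = record { extension = record { L = L ; ι = ι ; ι-mono = ι-mono } ; root = w ; isRoot = w-root }

-- Opaque because unfolding these case splits on an abstract enumeration makes type checking of
-- their uses very slow; only their types are ever needed.
opaque
  adjoinRoot : ∀ {c ℓ} (K : FiniteField c ℓ) s n → ExtensionWithRoot K s n
  adjoinRoot K s n with FiniteFieldProperties.quadratic-root? K s n
  ... | yes (z , root) = record { extension = trivialExtension K ; root = z ; isRoot = root }
  ... | no  noRoot     = QuadraticExtension.extensionWithRoot K s n noRoot

  quadraticExtension : ∀ {c ℓ} (K : FiniteField c ℓ) →
                       Σ (Extension K) λ E → FiniteField.size (Extension.L E) ≡ FiniteField.size K ℕ.* FiniteField.size K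
  quadraticExtension K with FiniteFieldProperties.∃-irreducible-z²-az+1 K
  ... | a , irreducible =
    ExtensionWithRoot.extension (QuadraticExtension.extensionWithRoot K a (FiniteField.1# K) irreducible) , ≡.refl

  quarticExtension : ∀ {c ℓ} (K : FiniteField c ℓ) →
                     Σ (Extension K) λ E → FiniteField.size (Extension.L E) ≡ FiniteField.size K ℕ.^ 4
  quarticExtension K with quadraticExtension K
  ... | E₁ , size₁≡q² with quadraticExtension (Extension.L E₁)
  ...   | E₂ , size₂≡size₁² =
    extend E₁ E₂ , ≡.trans size₂≡size₁² (≡.trans (≡.cong (λ m → m ℕ.* m) size₁≡q²) (q*q*[q*q]≡q⁴ (FiniteField.size K)))
    where
    q*q*[q*q]≡q⁴ : ∀ q → q ℕ.* q ℕ.* (q ℕ.* q) ≡ q ℕ.* (q ℕ.* (q ℕ.* (q ℕ.* 1)))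
    q*q*[q*q]≡q⁴ = solve-∀

module _ {c ℓ} (L : FiniteField c ℓ) where
  open FiniteField L
  open FiniteFieldProperties L
  open RingProperties commutativeRing
  open ℤ-Solver commutativeRing
  open import Algebra.Properties.Group +-group using () renaming (x∙y⁻¹≈ε⇒x≈y to x-y≈0⇒x≈y)
  open import Relation.Binary.Reasoning.Setoid setoid

  module _ {τ} (τ-homo : IsRingHomomorphism rawRing rawRing τ) where
    open HomomorphismProperties {R = commutativeRing} {S = commutativeRing} τ-homo

    -- τ r is again a root, hence r or the other root s - r; either way τ (τ r) ≈ r.
    homomorphism²-fixes-roots : ∀ {s n r} → τ s ≈ s → τ n ≈ n → quadratic s n r ≈ 0# → τ (τ r) ≈ r
    homomorphism²-fixes-roots {s} {n} {r} τs≈s τn≈n root with zero-product (begin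
      (τ r - r) * (τ r - (s - r))
        ≈⟨ solve 4 (λ X r s n → (X :- r) :* (X :- (s :- r)) := (X :* X :- s :* X :+ n) :- (r :* r :- s :* r :+ n))
                   refl (τ r) r s n ⟩
      quadratic s n (τ r) - quadratic s n r        ≈⟨ +-cong τ-root (-‿cong root) ⟩
      0# - 0#                                      ≈⟨ -‿inverseʳ 0# ⟩
      0#                                           ∎)
      where
      τ-root : quadratic s n (τ r) ≈ 0#
      τ-root = quadratic-root-homo τs≈s τn≈n root
    ... | inj₁ τr-r≈0   = trans (⟦⟧-cong (x-y≈0⇒x≈y _ _ τr-r≈0)) (x-y≈0⇒x≈y _ _ τr-r≈0)
    ... | inj₂ τr-s+r≈0 = begin
      τ (τ r)          ≈⟨ ⟦⟧-cong (x-y≈0⇒x≈y _ _ τr-s+r≈0) ⟩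
      τ (s - r)        ≈⟨ homo-minus τs≈s (x-y≈0⇒x≈y _ _ τr-s+r≈0) ⟩
      s - (s - r)      ≈⟨ solve 2 (λ s r → s :- (s :- r) := r) refl s r ⟩
      r                ∎

    homomorphism-fixes-t+t′ : ∀ {t t′} → t * t′ ≈ 1# → τ t ≈ t ⊎ τ t ≈ t′ → τ (t + t′) ≈ t + t′
    homomorphism-fixes-t+t′ {t} {t′} tt′≈1 τt≈ = trans (+-homo t t′) (τ-fixes-pair τt≈)
      where
      τt*τt′≈1 : τ t * τ t′ ≈ 1#
      τt*τt′≈1 = trans (sym (*-homo t t′)) (trans (⟦⟧-cong tt′≈1) 1#-homo)
      τ-fixes-pair : τ t ≈ t ⊎ τ t ≈ t′ → τ t + τ t′ ≈ t + t′
      τ-fixes-pair (inj₁ τt≈t)  = +-cong τt≈t (inverse-unique (trans (*-congʳ (sym τt≈t)) τt*τt′≈1) tt′≈1)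
      τ-fixes-pair (inj₂ τt≈t′) = trans (+-cong τt≈t′ (inverse-unique (trans (*-congʳ (sym τt≈t′)) τt*τt′≈1)
                                                                     (trans (*-comm t′ t) tt′≈1)))
                                        (+-comm t′ t)

module PrimePowerField {c ℓ} (F : FiniteField c ℓ) {p} (p-prime : Prime p)
                       (q-isPowerOf-p : IsPowerOf p (FiniteField.size F)) where
  private
    module F = FiniteField F
    module F′ = FiniteFieldProperties F
  open import Algebra.Properties.Semiring.Mult F.semiring using (×1-homo-*) renaming (_×_ to _·ᶠ_)
  open import Algebra.Properties.Semiring.Exp F.semiring using () renaming (_^_ to _^ᶠ_)

  q n : ℕ
  q = F.size
  n = proj₁ q-isPowerOf-p

  q≡pⁿ : q ≡ p ℕ.^ n
  q≡pⁿ = proj₂ q-isPowerOf-p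

  M : ℕ
  M = q ℕ.^ 4 ∸ 1

  1+M≡q⁴ : suc M ≡ q ℕ.^ 4
  1+M≡q⁴ = ℕ.m+[n∸m]≡n (ℕ.m^n>0 q {{ℕ.>-nonZero (ℕ.<-trans (s≤s z≤n) (F′.2≤size))}} 4)

  2≤M : 2 ≤ M
  2≤M = ℕ.∸-monoˡ-≤ 1 (ℕ.≤-trans (s≤s (s≤s (s≤s z≤n))) (ℕ.^-monoˡ-≤ 4 (F′.2≤size)))

  1+[q²∸1]≡q² : suc (q ℕ.* q ∸ 1) ≡ q ℕ.* q
  1+[q²∸1]≡q² = ℕ.m+[n∸m]≡n (ℕ.*-mono-≤ (ℕ.<⇒≤ F′.2≤size) (ℕ.<⇒≤ F′.2≤size))

  M≡[q²∸1]*[1+q²] : M ≡ (q ℕ.* q ∸ 1) ℕ.* suc (q ℕ.* q)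
  M≡[q²∸1]*[1+q²] = ℕ.suc-injective (begin
    suc M                              ≡⟨ 1+M≡q⁴ ⟩
    q ℕ.^ 4                            ≡⟨ q⁴≡q²*q² q ⟩
    (q ℕ.* q) ℕ.* (q ℕ.* q)             ≡⟨ ≡.cong (λ m → m ℕ.* m) 1+[q²∸1]≡q² ⟨
    suc Q′ ℕ.* suc Q′                  ≡⟨ [1+Q]²≡1+Q*[2+Q] Q′ ⟩
    suc (Q′ ℕ.* suc (suc Q′))           ≡⟨ ≡.cong (λ m → suc (Q′ ℕ.* suc m)) 1+[q²∸1]≡q² ⟩
    suc (Q′ ℕ.* suc (q ℕ.* q))          ∎)
    where
    open ≡.≡-Reasoning
    Q′ : ℕ
    Q′ = q ℕ.* q ∸ 1
    q⁴≡q²*q² : ∀ q → q ℕ.* (q ℕ.* (q ℕ.* (q ℕ.* 1))) ≡ (q ℕ.* q) ℕ.* (q ℕ.* q)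
    q⁴≡q²*q² = solve-∀
    [1+Q]²≡1+Q*[2+Q] : ∀ Q → (1 ℕ.+ Q) ℕ.* (1 ℕ.+ Q) ≡ 1 ℕ.+ Q ℕ.* (2 ℕ.+ Q)
    [1+Q]²≡1+Q*[2+Q] = solve-∀

  p·1≈0 : p ·ᶠ F.1# F.≈ F.0#
  p·1≈0 = F′.x^n≈0⇒x≈0 n (begin
    (p ·ᶠ F.1#) ^ᶠ n     ≈⟨ pᵐ·1≈[p·1]ᵐ n ⟨
    (p ℕ.^ n) ·ᶠ F.1#    ≡⟨ ≡.cong (_·ᶠ F.1#) q≡pⁿ ⟨
    q ·ᶠ F.1#            ≈⟨ F′.size·1≈0 ⟩
    F.0#                 ∎)
    where
    open import Relation.Binary.Reasoning.Setoid F.setoid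
    pᵐ·1≈[p·1]ᵐ : ∀ m → (p ℕ.^ m) ·ᶠ F.1# F.≈ (p ·ᶠ F.1#) ^ᶠ m
    pᵐ·1≈[p·1]ᵐ zero    = F.+-identityʳ F.1#
    pᵐ·1≈[p·1]ᵐ (suc m) = F.trans (×1-homo-* p (p ℕ.^ m)) (F.*-congˡ (pᵐ·1≈[p·1]ᵐ m))

  module OnExtension (E : Extension F) where
    open Extension E
    open FiniteField L
    open FiniteFieldProperties L
    open HomomorphismProperties {R = F.commutativeRing} {S = commutativeRing} ι-homo
    open import Algebra.Properties.Semiring.Exp semiring using (_^_; ^-congˡ; ^-assocʳ)
    open import Algebra.Properties.Semiring.Mult semiring using () renaming (_×_ to _·ᴸ_; ×-congʳ to ·ᴸ-congʳ)
    open import Relation.Binary.Reasoning.Setoid setoid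

    σ : Carrier → Carrier
    σ x = x ^ q

    σ-homo : IsRingHomomorphism rawRing rawRing σ
    σ-homo = ≡.subst (λ e → IsRingHomomorphism rawRing rawRing (_^ e)) (≡.sym q≡pⁿ)
                     (Frobenius.frobenius-isRingHomomorphism commutativeRing p-prime p·1≈0ᴸ n)
      where
      p·1≈0ᴸ : p ·ᴸ 1# ≈ 0#
      p·1≈0ᴸ = begin
        p ·ᴸ 1#        ≈⟨ ·ᴸ-congʳ p 1#-homo ⟨
        p ·ᴸ ι F.1#    ≈⟨ ·-homo p F.1# ⟨
        ι (p ·ᶠ F.1#)  ≈⟨ ⟦⟧-cong p·1≈0 ⟩
        ι F.0#         ≈⟨ 0#-homo ⟩
        0#             ∎

    σ-fixes-ι : ∀ a → σ (ι a) ≈ ι a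
    σ-fixes-ι a = trans (sym (^-homo a q)) (⟦⟧-cong (F′.x^size≈x a))

    σ²-homo : IsRingHomomorphism rawRing rawRing (σ ∘ σ)
    σ²-homo = Composition.isRingHomomorphism trans σ-homo σ-homo

    σ²≈^q² : ∀ x → σ (σ x) ≈ x ^ (q ℕ.* q)
    σ²≈^q² x = ^-assocʳ x q q

    σ⁴≈^q⁴ : ∀ x → σ (σ (σ (σ x))) ≈ x ^ (q ℕ.^ 4)
    σ⁴≈^q⁴ x = begin
      (((x ^ q) ^ q) ^ q) ^ q   ≈⟨ ^-congˡ q (^-congˡ q (^-assocʳ x q q)) ⟩
      ((x ^ (q ℕ.* q)) ^ q) ^ q  ≈⟨ ^-congˡ q (^-assocʳ x (q ℕ.* q) q) ⟩
      (x ^ (q ℕ.* q ℕ.* q)) ^ q  ≈⟨ ^-assocʳ x (q ℕ.* q ℕ.* q) q ⟩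
      x ^ (q ℕ.* q ℕ.* q ℕ.* q)  ≡⟨ ≡.cong (x ^_) (q*q*q*q≡q^4 q) ⟩
      x ^ (q ℕ.^ 4)              ∎
      where
      q*q*q*q≡q^4 : ∀ q → q ℕ.* q ℕ.* q ℕ.* q ≡ q ℕ.* (q ℕ.* (q ℕ.* (q ℕ.* 1)))
      q*q*q*q≡q^4 = solve-∀

    -- Otherwise z and the images of the q elements of F would be q + 1 roots of X^q - X.
    σ-fixed⇒∈ι : ∀ {z} → σ z ≈ z → ∃ λ a → ι a ≈ z
    σ-fixed⇒∈ι {z} σz≈z =
      Dec.decidable-stable (F′.∃? (λ a≈b ιa≈z → trans (⟦⟧-cong (F.sym a≈b)) ιa≈z) (λ a → ι a ≟ z)) z∈ι
      where
      z∈ι : ¬ ¬ ∃ λ a → ι a ≈ z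
      z∈ι z∉ι = ℕ.<-irrefl ≡.refl (fixed-points-of-power-bound F′.2≤size points points-injective points-fixed)
        where
        points : Fin (suc q) → Carrier
        points Fin.zero    = z
        points (Fin.suc i) = ι (F′.enum i)
        points-injective : ∀ i j → points i ≈ points j → i ≡ j
        points-injective Fin.zero    Fin.zero    _ = ≡.refl
        points-injective Fin.zero    (Fin.suc j) z≈ιj = ⊥-elim (z∉ι (F′.enum j , sym z≈ιj))
        points-injective (Fin.suc i) Fin.zero    ιi≈z = ⊥-elim (z∉ι (F′.enum i , ιi≈z))
        points-injective (Fin.suc i) (Fin.suc j) ιi≈ιj = ≡.cong Fin.suc (F′.enum-injective i j (ι-injective ιi≈ιj))
        points-fixed : ∀ i → points i ^ q ≈ points i
        points-fixed Fin.zero    = σz≈z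
        points-fixed (Fin.suc i) = σ-fixes-ι (F′.enum i)

    σ-cong : ∀ {x y} → x ≈ y → σ x ≈ σ y
    σ-cong = ^-congˡ q

module _ {c ℓ} (F : FiniteField c ℓ) {p} (p-prime : Prime p) (q-isPowerOf-p : IsPowerOf p (FiniteField.size F))
  where
  private
    module F = FiniteField F
    𝔽 : CommutativeRing c ℓ
    𝔽 = F.commutativeRing
  open PrimePowerField F p-prime q-isPowerOf-p

  record QuadraticTower (x y : F.Carrier) : Set (lsuc (c ⊔ ℓ)) where
    field
      extension : Extension F
    open Extension extension public
    open FiniteField L using (Carrier; _≈_; _-_; 0#; 1#; commutativeRing)
    open RingProperties commutativeRing using (quadratic)
    field
      a t u  : Carrier
      a-root : quadratic (ι x) (ι y) a ≈ 0#
      t-root : quadratic a 1# t ≈ 0#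
      u-root : quadratic (ι x - a) 1# u ≈ 0#

  quadraticTower : ∀ x y → QuadraticTower x y
  quadraticTower x y = record
    { extension = extend (extend E₁.extension E₂.extension) E₃.extension
    ; a = ι₃ (E₂.ι E₁.root)
    ; t = ι₃ E₂.root
    ; u = E₃.root
    ; a-root = H₃₂.quadratic-root-homo L.refl L.refl E₁.isRoot
    ; t-root = H₃.quadratic-root-homo L.refl H₃₂.1#-homo E₂.isRoot
    ; u-root = L.trans (quadratic-cong (L.sym (H₃₂.minus-homo _ _)) (L.sym H₃.1#-homo) L.refl) E₃.isRoot
    }
    where
    module E₁ = ExtensionWithRoot (adjoinRoot F x y)
    module E₂ = ExtensionWithRoot (adjoinRoot E₁.L E₁.root (FiniteField.1# E₁.L))
    module E₃ = ExtensionWithRoot (adjoinRoot E₂.L (E₂.ι (FiniteField._-_ E₁.L (E₁.ι x) E₁.root)) (FiniteField.1# E₂.L))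
    module L = FiniteField E₃.L
    ι₃ : FiniteField.Carrier E₂.L → L.Carrier
    ι₃ = E₃.ι
    open RingProperties L.commutativeRing using (quadratic-cong)
    module H₃ = HomomorphismProperties {R = FiniteField.commutativeRing E₂.L} {S = L.commutativeRing} E₃.ι-homo
    module H₃₂ = HomomorphismProperties {R = FiniteField.commutativeRing E₁.L} {S = L.commutativeRing}
                                        (Extension.ι-homo (extend E₂.extension E₃.extension))

  module _ {x y} (T : QuadraticTower x y) where
    open QuadraticTower T
    open FiniteField L
    open OnExtension extension
    open RingProperties commutativeRing
    open Lucas commutativeRing using (Φ)
    open ℤ-Solver commutativeRing
    open HomomorphismProperties {R = commutativeRing} {S = commutativeRing} σ²-homo using ()
      renaming (homo-minus to σ²-homo-minus; 1#-homo to σ²-1#-homo)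
    open import Algebra.Properties.Semiring.Exp semiring using (_^_)

    private
      b t′ u′ : Carrier
      b = ι x - a
      t′ = a - t
      u′ = b - u

      z≈s+[z-s] : ∀ s z → z ≈ s + (z - s)
      z≈s+[z-s] s z = solve 2 (λ s z → z := s :+ (z :- s)) refl s z

      ι-Φ : _≈²_ commutativeRing (ι x , ι y) (Φ (t + t′) (u + u′))
      ι-Φ = ι-Φ₁ , ι-Φ₂
        where
        open import Relation.Binary.Reasoning.Setoid setoid
        ι-Φ₁ : ι x ≈ (t + t′) + (u + u′)
        ι-Φ₁ = begin
          ι x                   ≈⟨ z≈s+[z-s] a (ι x) ⟩
          a + b                 ≈⟨ +-cong (z≈s+[z-s] t a) (z≈s+[z-s] u b) ⟩
          (t + t′) + (u + u′)   ∎
        ι-Φ₂ : ι y ≈ (t + t′) * (u + u′)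
        ι-Φ₂ = begin
          ι y                   ≈⟨ quadratic≈0⇒z*[s-z]≈n a-root ⟨
          a * b                 ≈⟨ *-cong (z≈s+[z-s] t a) (z≈s+[z-s] u b) ⟩
          (t + t′) * (u + u′)   ∎

      σ²a≈a : σ (σ a) ≈ a
      σ²a≈a = homomorphism²-fixes-roots L σ-homo (σ-fixes-ι x) (σ-fixes-ι y) a-root

      σ²b≈b : σ (σ b) ≈ b
      σ²b≈b = σ²-homo-minus (trans (σ-cong (σ-fixes-ι x)) (σ-fixes-ι x)) σ²a≈a

      periodic : ∀ {s z} → σ (σ s) ≈ s → quadratic s 1# z ≈ 0# → z ^ (q ℕ.^ 4) ≈ z
      periodic {s} {z} σ²s≈s root = trans (sym (σ⁴≈^q⁴ z)) (homomorphism²-fixes-roots L σ²-homo σ²s≈s σ²-1#-homo root)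

    𝓑-roundtrip : ∀ k m {j} → k ℕ.* m ≡ suc (j ℕ.* M) →
                  _≈²_ 𝔽 (𝓑 𝔽 m (𝓑 𝔽 k (x , y))) (x , y)
    𝓑-roundtrip k m {j} km≡1+jM = Product.map ι-injective ι-injective (begin
      Product.map ι ι (𝓑 𝔽 m (𝓑 𝔽 k (x , y)))
        ≈⟨ 𝓑-homo ι-homo (𝓑-homo ι-homo (refl , refl) k) m ⟩
      𝓑 commutativeRing m (𝓑 commutativeRing k (ι x , ι y))
        ≈⟨ 𝓑-cong commutativeRing (𝓑-cong commutativeRing ι-Φ k) m ⟩
      𝓑 commutativeRing m (𝓑 commutativeRing k (Φ (t + t′) (u + u′)))
        ≈⟨ 𝓑∘𝓑-Φ commutativeRing (quadratic≈0⇒z*[s-z]≈n t-root) (quadratic≈0⇒z*[s-z]≈n u-root) k m ⟩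
      Φ (t ^ (k ℕ.* m) + t′ ^ (k ℕ.* m)) (u ^ (k ℕ.* m) + u′ ^ (k ℕ.* m))
        ≈⟨ Φ-cong commutativeRing (+-cong (fixed σ²a≈a t-root) (fixed σ²a≈a t′-root))
                                   (+-cong (fixed σ²b≈b u-root) (fixed σ²b≈b u′-root)) ⟩
      Φ (t + t′) (u + u′)
        ≈⟨ ι-Φ ⟨
      (ι x , ι y) ∎)
      where
      open import Relation.Binary.Reasoning.Setoid (×-setoid setoid setoid)
      t′-root : quadratic a 1# t′ ≈ 0#
      t′-root = trans (quadratic-conjugate a 1# t) t-root
      u′-root : quadratic b 1# u′ ≈ 0#
      u′-root = trans (quadratic-conjugate b 1# u) u-root
      fixed : ∀ {s z} → σ (σ s) ≈ s → quadratic s 1# z ≈ 0# → z ^ (k ℕ.* m) ≈ z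
      fixed {s} {z} σ²s≈s root = trans (reflexive (≡.cong (z ^_) km≡1+jM))
        (x^[1+m]≈x⇒x^[1+j*m]≈x (trans (reflexive (≡.cong (z ^_) 1+M≡q⁴)) (periodic σ²s≈s root)) j)

  gcd≡1⇒𝓑-permutation : ∀ {k} → gcd M k ≡ 1 → IsPermutation 𝔽 (𝓑 𝔽 k)
  gcd≡1⇒𝓑-permutation {k} gcd≡1 with ∃-inverse-mod 2≤M gcd≡1
  ... | m , j , km≡1+jM = injective , surjective
    where
    open import Relation.Binary.Reasoning.Setoid (×-setoid F.setoid F.setoid)
    roundtrip : ∀ k m → k ℕ.* m ≡ suc (j ℕ.* M) → ∀ w → _≈²_ 𝔽 (𝓑 𝔽 m (𝓑 𝔽 k w)) w
    roundtrip k m km≡ (x , y) = 𝓑-roundtrip (quadraticTower x y) k m {j} km≡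
    injective : ∀ w w′ → _≈²_ 𝔽 (𝓑 𝔽 k w) (𝓑 𝔽 k w′) → _≈²_ 𝔽 w w′
    injective w w′ 𝓑w≈𝓑w′ = begin
      w                 ≈⟨ roundtrip k m km≡1+jM w ⟨
      𝓑 𝔽 m (𝓑 𝔽 k w)   ≈⟨ 𝓑-cong 𝔽 𝓑w≈𝓑w′ m ⟩
      𝓑 𝔽 m (𝓑 𝔽 k w′)  ≈⟨ roundtrip k m km≡1+jM w′ ⟩
      w′                ∎
    surjective : ∀ w → ∃ λ w′ → _≈²_ 𝔽 (𝓑 𝔽 k w′) w
    surjective w = 𝓑 𝔽 m w , roundtrip m k (≡.trans (ℕ.*-comm m k) km≡1+jM) w

module _ {c ℓ} (F : FiniteField c ℓ) {p} (p-prime : Prime p) (q-isPowerOf-p : IsPowerOf p (FiniteField.size F))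
  where
  private
    module F = FiniteField F
    𝔽 : CommutativeRing c ℓ
    𝔽 = F.commutativeRing
  open PrimePowerField F p-prime q-isPowerOf-p

  module Collision {r k} (r-prime : Prime r) (r∣M : r ∣ M) (r∣k : r ∣ k) where
    private
      E : Extension F
      E = proj₁ (quarticExtension F)
    open Extension E
    open FiniteField L
    open FiniteFieldProperties L
    open OnExtension E
    open RingProperties commutativeRing
    open import Algebra.Properties.Semiring.Exp semiring using (_^_)

    private
      nontrivial-root : ∃ λ t → t ^ r ≈ 1# × t ≉ 1#
      nontrivial-root = ∃-nontrivial-root-of-unity {d = _∣_.quotient r∣M} (prime⇒2≤ r-prime)
        (≡.trans (proj₂ (quarticExtension F)) (≡.trans (≡.sym 1+M≡q⁴) (≡.cong suc (_∣_.equality r∣M))))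

      t t⁻¹ : Carrier
      t = proj₁ nontrivial-root
      t⁻¹ = t ^ ℕ.pred r

      t^r≈1 : t ^ r ≈ 1#
      t^r≈1 = proj₁ (proj₂ nontrivial-root)

      t≉1 : t ≉ 1#
      t≉1 = proj₂ (proj₂ nontrivial-root)

      t*t⁻¹≈1 : t * t⁻¹ ≈ 1#
      t*t⁻¹≈1 = trans (reflexive (≡.cong (t ^_) (ℕ.suc-pred r {{prime⇒nonZero r-prime}}))) t^r≈1

      -- r divides q ^ 4 - 1 = (q ^ 2 - 1) (q ^ 2 + 1), so t ^ (q ^ 2) is t or t⁻¹.
      σ²t≈t⊎t⁻¹ : σ (σ t) ≈ t ⊎ σ (σ t) ≈ t⁻¹
      σ²t≈t⊎t⁻¹ = Sum.map fixed inverted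
        (euclidsLemma (q ℕ.* q ∸ 1) (suc (q ℕ.* q)) r-prime (≡.subst (r ∣_) M≡[q²∸1]*[1+q²] r∣M))
        where
        open import Relation.Binary.Reasoning.Setoid setoid
        fixed : r ∣ q ℕ.* q ∸ 1 → σ (σ t) ≈ t
        fixed (divides e q²∸1≡e*r) = begin
          σ (σ t)                   ≈⟨ σ²≈^q² t ⟩
          t ^ (q ℕ.* q)             ≡⟨ ≡.cong (t ^_) 1+[q²∸1]≡q² ⟨
          t * t ^ (q ℕ.* q ∸ 1)     ≡⟨ ≡.cong (λ m → t * t ^ m) q²∸1≡e*r ⟩
          t * t ^ (e ℕ.* r)         ≈⟨ *-congˡ (x^r≈1⇒x^[e*r]≈1 t^r≈1 e) ⟩
          t * 1#                    ≈⟨ *-identityʳ t ⟩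
          t                         ∎
        inverted : r ∣ suc (q ℕ.* q) → σ (σ t) ≈ t⁻¹
        inverted (divides e 1+q²≡e*r) = inverse-unique (begin
          t * σ (σ t)               ≈⟨ *-congˡ (σ²≈^q² t) ⟩
          t ^ suc (q ℕ.* q)         ≡⟨ ≡.cong (t ^_) 1+q²≡e*r ⟩
          t ^ (e ℕ.* r)             ≈⟨ x^r≈1⇒x^[e*r]≈1 t^r≈1 e ⟩
          1#                        ∎) t*t⁻¹≈1

      α : Carrier
      α = t + t⁻¹

      σ²α≈α : σ (σ α) ≈ α
      σ²α≈α = homomorphism-fixes-t+t′ L σ²-homo t*t⁻¹≈1 σ²t≈t⊎t⁻¹

      module σ = HomomorphismProperties {R = commutativeRing} {S = commutativeRing} σ-homo

      x₀-lift : ∃ λ x₀ → ι x₀ ≈ α + σ α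
      x₀-lift = σ-fixed⇒∈ι (trans (σ.+-homo α (σ α)) (trans (+-congˡ σ²α≈α) (+-comm (σ α) α)))

      y₀-lift : ∃ λ y₀ → ι y₀ ≈ α * σ α
      y₀-lift = σ-fixed⇒∈ι (trans (σ.*-homo α (σ α)) (trans (*-congˡ σ²α≈α) (*-comm (σ α) α)))

      module ι = HomomorphismProperties {R = 𝔽} {S = commutativeRing} ι-homo
      open Lucas commutativeRing using (Φ; 𝓑-Φ)

      x*y≈1∧x≈1⇒y≈1 : ∀ {x y} → x * y ≈ 1# → x ≈ 1# → y ≈ 1#
      x*y≈1∧x≈1⇒y≈1 xy≈1 x≈1 = inverse-unique (trans (*-congʳ (sym x≈1)) xy≈1) (*-identityʳ 1#)

      t^k≈1 : t ^ k ≈ 1#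
      t^k≈1 = trans (reflexive (≡.cong (t ^_) (_∣_.equality r∣k))) (x^r≈1⇒x^[e*r]≈1 t^r≈1 (_∣_.quotient r∣k))

      σt*σt⁻¹≈1 : σ t * σ t⁻¹ ≈ 1#
      σt*σt⁻¹≈1 = trans (sym (σ.*-homo t t⁻¹)) (trans (σ.⟦⟧-cong t*t⁻¹≈1) σ.1#-homo)

      four≈two*two : four commutativeRing ≈ two commutativeRing * two commutativeRing
      four≈two*two = sym (trans (distribˡ _ 1# 1#) (+-cong (*-identityʳ _) (*-identityʳ _)))

      t⁻¹^k≈1 : t⁻¹ ^ k ≈ 1#
      t⁻¹^k≈1 = x*y≈1∧x≈1⇒y≈1 (x*y≈1⇒xⁿ*yⁿ≈1 t*t⁻¹≈1 k) t^k≈1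

      σ-pow≈1 : ∀ {z} → z ^ k ≈ 1# → σ z ^ k ≈ 1#
      σ-pow≈1 z^k≈1 = trans (sym (σ.^-homo _ k)) (trans (σ.⟦⟧-cong z^k≈1) σ.1#-homo)

    collision-point : F.Carrier × F.Carrier
    collision-point = proj₁ x₀-lift , proj₁ y₀-lift

    𝓑ₖ-collision : _≈²_ 𝔽 (𝓑 𝔽 k collision-point) (𝓑 𝔽 k (four 𝔽 , four 𝔽))
    𝓑ₖ-collision = Product.map ι-injective ι-injective (begin
      Product.map ι ι (𝓑 𝔽 k collision-point)
        ≈⟨ 𝓑-homo ι-homo (proj₂ x₀-lift , proj₂ y₀-lift) k ⟩
      𝓑 commutativeRing k (Φ α (σ α))
        ≈⟨ 𝓑-cong commutativeRing (Φ-cong commutativeRing refl (σ.+-homo t t⁻¹)) k ⟩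
      𝓑 commutativeRing k (Φ (t + t⁻¹) (σ t + σ t⁻¹))
        ≈⟨ 𝓑-Φ t*t⁻¹≈1 σt*σt⁻¹≈1 k ⟩
      Φ (t ^ k + t⁻¹ ^ k) (σ t ^ k + σ t⁻¹ ^ k)
        ≈⟨ Φ-cong commutativeRing (+-cong (≈1^k t^k≈1) (≈1^k t⁻¹^k≈1))
                                  (+-cong (≈1^k (σ-pow≈1 t^k≈1)) (≈1^k (σ-pow≈1 t⁻¹^k≈1))) ⟩
      Φ (1# ^ k + 1# ^ k) (1# ^ k + 1# ^ k)
        ≈⟨ 𝓑-Φ (*-identityʳ 1#) (*-identityʳ 1#) k ⟨
      𝓑 commutativeRing k (Φ (1# + 1#) (1# + 1#))
        ≈⟨ 𝓑-homo ι-homo (ι.four-homo , trans ι.four-homo four≈two*two) k ⟨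
      Product.map ι ι (𝓑 𝔽 k (four 𝔽 , four 𝔽)) ∎)
      where
      open import Relation.Binary.Reasoning.Setoid (×-setoid setoid setoid)
      ≈1^k : ∀ {z} → z ≈ 1# → z ≈ 1# ^ k
      ≈1^k z≈1 = trans z≈1 (sym (1^n≈1 k))

    collision-point≉four : ¬ _≈²_ 𝔽 collision-point (four 𝔽 , four 𝔽)
    collision-point≉four (x₀≈4 , y₀≈4) = t≉1 (sum-and-product⇒≈ t+t⁻¹≈2 (trans t*t⁻¹≈1 (sym (*-identityʳ 1#))))
      where
      t+t⁻¹≈2 : α ≈ 1# + 1#
      t+t⁻¹≈2 = sum-and-product⇒≈ (trans (sym (proj₂ x₀-lift)) (trans (ι.⟦⟧-cong x₀≈4) ι.four-homo))
                                  (trans (sym (proj₂ y₀-lift)) (trans (ι.⟦⟧-cong y₀≈4) (trans ι.four-homo four≈two*two)))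

  𝓑-permutation⇒gcd≡1 : ∀ {k} → IsPermutation 𝔽 (𝓑 𝔽 k) → gcd M k ≡ 1
  𝓑-permutation⇒gcd≡1 {k} (𝓑ₖ-injective , _) =
    Dec.decidable-stable (gcd M k ℕ.≟ 1) (λ gcd≢1 → no-common-prime (∃-common-prime-factor M k M≢0 gcd≢1))
    where
    M≢0 : M ≢ 0
    M≢0 M≡0 = ℕ.<⇒≢ (ℕ.<-trans (s≤s z≤n) 2≤M) (≡.sym M≡0)
    no-common-prime : ¬ ∃ λ r → Prime r × r ∣ M × r ∣ k
    no-common-prime (r , r-prime , r∣M , r∣k) = collision-point≉four (𝓑ₖ-injective _ _ 𝓑ₖ-collision)
      where open Collision r-prime r∣M r∣k

open import Data.Nat using (_^_)
open import Function.Bundles using (_⇔_; mk⇔)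

theorem2p5 : ∀ {c ℓ} (p q k : ℕ) → Prime p → IsPowerOf p q →
    (F : CommutativeRing c ℓ) → IsField F → HasCardinality F q →
    (IsPermutation F (𝓑 F k) ⇔ (gcd (q ^ 4 ∸ 1) k ≡ 1))
theorem2p5 {c} {ℓ} p q k p-prime q-isPowerOf-p F F-isField F-hasCardinality =
  mk⇔ (𝓑-permutation⇒gcd≡1 K p-prime q-isPowerOf-p) (gcd≡1⇒𝓑-permutation K p-prime q-isPowerOf-p)
  where
  K : FiniteField c ℓ
  K = record { commutativeRing = F ; isField = F-isField ; size = q ; hasCardinality = F-hasCardinality }
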